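{- Let $p$ be a prime and $(r,e,d)\in\mathscr{B}_0(p)$ with $p\mid r$. Then $r=p$, $e=p-1$, $d=p-1$, and if $\varepsilon\in\mathbb{F}_p$ satisfies $\det M_d(f(x)^e)=\varepsilon\,\delta(x_1,\dots,x_r)^{2e-(p-1)}$, then $\varepsilon=1$ when $p\equiv1,2\pmod 4$ and $\varepsilon=-1$ when $p\equiv 3\pmod 4$.
   Context: $\mathscr{B}_0(p)=\{(r,e,d)\in\mathbb{Z}^3: 2\le r\le p+1,\ (p-1)/2<e\le p-1,\ r(p-1-e)\le p-1,\ d=r-1\}$. Let $x_1,\dots,x_r$ be independent indeterminates over $\mathbb{F}_p$, $f(x)=(x-x_1)\cdots(x-x_r)$, $\delta(x_1,\dots,x_r)=\prod_{1\le i<j\le r}(x_i-x_j)$. For $e\ge0$ write $f(x)^e=\sum_{i\ge0}c_ix^i$ and let $M_d(f(x)^e)$ be the $d\times d$ matrix with $(i,j)$ entry $c_{ip+j-d-1}$ ($1\le i,j\le d$). -}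

module Defs where

open import Data.Nat as ℕ using (ℕ; zero; suc; _∸_; _≤_; _<_; _<ᵇ_)
open import Data.Integer as ℤ using (ℤ; +_; -[1+_])
import Data.Integer.Divisibility as ℤDiv
open import Data.Fin as Fin using (Fin; toℕ; punchIn)
open import Data.List as List using (List; []; _∷_; map; foldr; allFin)
open import Data.List.Relation.Unary.All using (All)
open import Data.Bool using (if_then_else_)
open import Data.Product using (_×_)
open import Relation.Binary.PropositionalEquality using (_≡_)

-- Polynomials over ℤ in n variables (dense, nested representation):
--   Poly 0       = ℤ
--   Poly (suc n) = coefficient lists (lowest degree first) over Poly n.
-- Reduction mod p is handled by the equality `EqP p n` below, so that
-- `Poly n` with `EqP p n` is the polynomial ring 𝔽_p[x_1,…,x_n].

Poly : ℕ → Set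
Poly zero    = ℤ
Poly (suc n) = List (Poly n)

zeroP : ∀ n → Poly n
zeroP zero    = + 0
zeroP (suc n) = []

constP : ∀ n → ℤ → Poly n
constP zero    a = a
constP (suc n) a = constP n a ∷ []

oneP : ∀ n → Poly n
oneP n = constP n (+ 1)

addP : ∀ n → Poly n → Poly n → Poly n
addP zero    a        b        = a ℤ.+ b
addP (suc n) []       q        = q
addP (suc n) (a ∷ as) []       = a ∷ as
addP (suc n) (a ∷ as) (b ∷ bs) = addP n a b ∷ addP (suc n) as bs

negP : ∀ n → Poly n → Poly n
negP zero    a = ℤ.- a
negP (suc n) q = map (negP n) q

subP : ∀ n → Poly n → Poly n → Poly n
subP n a b = addP n a (negP n b)

mulP : ∀ n → Poly n → Poly n → Poly n
mulP zero    a        b = a ℤ.* b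
mulP (suc n) []       q = []
mulP (suc n) (a ∷ as) q = addP (suc n) (map (mulP n a) q) (zeroP n ∷ mulP (suc n) as q)

powP : ∀ n → Poly n → ℕ → Poly n
powP n a zero    = oneP n
powP n a (suc k) = mulP n a (powP n a k)

sumP : ∀ n → List (Poly n) → Poly n
sumP n = foldr (addP n) (zeroP n)

prodP : ∀ n → List (Poly n) → Poly n
prodP n = foldr (mulP n) (oneP n)

IsZeroP : ℕ → ∀ n → Poly n → Set
IsZeroP p zero    a = (+ p) ℤDiv.∣ a
IsZeroP p (suc n) q = All (IsZeroP p n) q

EqP : ℕ → ∀ n → Poly n → Poly n → Set
EqP p n a b = IsZeroP p n (subP n a b)

_≡_[modℤ_] : ℤ → ℤ → ℕ → Set
a ≡ b [modℤ p ] = EqP p 0 a b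

-- The indeterminates: var n i is x_{i+1} in Poly n (i : Fin n).
var : ∀ n → Fin n → Poly n
var (suc n) Fin.zero    = zeroP n ∷ oneP n ∷ []
var (suc n) (Fin.suc i) = var n i ∷ []

-- f(x) = (x - x_1)⋯(x - x_r), as an element of Poly (suc r) =
-- (𝔽_p[x_1,…,x_r])[x]: the outermost variable var (suc r) zero plays x,
-- and var (suc r) (suc i) is the constant polynomial x_{i+1}.

fPoly : ∀ r → Poly (suc r)
fPoly r = prodP (suc r)
  (map (λ i → subP (suc r) (var (suc r) Fin.zero) (var (suc r) (Fin.suc i))) (allFin r))

coeff : ∀ n → Poly (suc n) → ℕ → Poly n
coeff n []       k       = zeroP n
coeff n (a ∷ as) zero    = a
coeff n (a ∷ as) (suc k) = coeff n as k

coeffℤ : ∀ n → Poly (suc n) → ℤ → Poly n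
coeffℤ n q (+ k)     = coeff n q k
coeffℤ n q -[1+ k ]  = zeroP n

-- M_d(g): d×d matrix with (i,j) entry c_{ip+j-d-1}, 1 ≤ i,j ≤ d,
-- where g = Σ c_k x^k (Fin index a ↦ a+1).
Mmat : ℕ → ∀ n d → Poly (suc n) → Fin d → Fin d → Poly n
Mmat p n d g i j =
  coeffℤ n g ((+ (suc (toℕ i) ℕ.* p ℕ.+ suc (toℕ j))) ℤ.- (+ (d ℕ.+ 1)))

signP : ∀ n → ℕ → Poly n → Poly n
signP n zero    a = a
signP n (suc k) a = negP n (signP n k a)

det : ∀ n m → (Fin m → Fin m → Poly n) → Poly n
det n zero    M = oneP n
det n (suc m) M = sumP n (map (λ j →
  signP n (toℕ j) (mulP n (M Fin.zero j) (det n m (λ a b → M (Fin.suc a) (punchIn j b)))))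
  (allFin (suc m)))

delta : ∀ r → Poly r
delta r = prodP r (List.concatMap (λ i → map (λ j →
  if toℕ i <ᵇ toℕ j then subP r (var r i) (var r j) else oneP r) (allFin r)) (allFin r))

InB0 : ℕ → ℕ → ℕ → ℕ → Set
InB0 p r e d =
  (2 ≤ r) × (r ≤ suc p) ×
  ((p ∸ 1) < 2 ℕ.* e) × (e ≤ p ∸ 1) ×
  (r ℕ.* (p ∸ 1 ∸ e) ≤ p ∸ 1) × (d ≡ r ∸ 1)

{-# OPTIONS --safe #-}
-- Divisibility forces r = p and e = d = p − 1, so δ enters with exponent p − 1.  Specialise
-- x_{i+1} ↦ i for i < p.  Then δ becomes a product of non-zero residues, so δ^(p−1) ≡ 1 by
-- Fermat, and f becomes ∏_{i<p} (x − i), which is ≡ x^p − x mod p: both are monic of degree p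
-- and vanish at every residue.  Hence ε ≡ det M_{p−1}((x^p − x)^(p−1)).  Now
-- (x^p − x)^(p−1) = Σ_k C(p−1,k) (−1)^(p−1−k) x^((p−1)(k+1)) and C(p−1,k) ≡ (−1)^k, so the
-- matrix is ≡ the (p−1)×(p−1) anti-diagonal matrix, whose determinant (−1)^((p−1)(p−2)/2)
-- only depends on p mod 4.
module Submission where

open import Defs
open import Data.Nat using (ℕ; zero; suc)
open import Data.Fin using (Fin)
open import Data.Nat.Primality using (Prime)
open import Function using (_∘_)
open import Relation.Binary.PropositionalEquality using (_≡_; refl; sym; trans; cong; cong₂; subst; subst₂)

module Congruence (p : ℕ) where

  open import Data.Nat using (_∸_)
  import Data.Nat as ℕ
  import Data.Nat.Properties as ℕ
  open import Data.Nat.Divisibility as ℕ using ()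
  open import Data.Nat.Primality using (euclidsLemma; prime⇒nonTrivial)
  open import Data.Integer using (ℤ; +_; _+_; _-_; _*_; -_; _^_; ∣_∣; 0ℤ; 1ℤ)
  open import Data.Fin using (toℕ; punchIn)
  open import Data.List using ([]; _∷_; map; allFin)
  open import Data.List.Relation.Unary.All using (All; []; _∷_)
  import Data.Integer.Properties as ℤ
  open import Data.Integer.DivMod using (_%ℕ_; _/ℕ_; a≡a%ℕn+[a/ℕn]*n)
  open import Data.Integer.Divisibility.Signed
    using (_∣_; divides; ∣m∣n⇒∣m+n; ∣m⇒∣-m; ∣n⇒∣m*n; ∣m⇒∣m*n; ∣⇒∣ᵤ; ∣ᵤ⇒∣)
  open import Data.Sum using (_⊎_; inj₁; inj₂)
  open import Relation.Nullary using (¬_; contradiction)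
  open Relation.Binary.PropositionalEquality.≡-Reasoning
  open import Data.Integer.Tactic.RingSolver using (solve-∀)
  open import Relation.Binary.Bundles using (Setoid)
  open import Relation.Binary.Structures using (IsEquivalence)
  import Relation.Binary.Reasoning.Setoid as SetoidReasoning

  -- A record rather than Defs' _≡_[modℤ_], so that a and b can be inferred from a ≈ b.
  infix 4 _≈_
  record _≈_ (a b : ℤ) : Set where
    constructor congruent
    field p∣difference : + p ∣ a - b
  open _≈_ public

  private
    p∣-subst : ∀ {a b} → a ≡ b → + p ∣ a → + p ∣ b
    p∣-subst refl h = h

  ≈-refl : ∀ {a} → a ≈ a
  ≈-refl {a} = congruent (p∣-subst (sym (ℤ.+-inverseʳ a)) (divides 0ℤ refl))

  ≈-reflexive : ∀ {a b} → a ≡ b → a ≈ b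
  ≈-reflexive refl = ≈-refl

  ≈-sym : ∀ {a b} → a ≈ b → b ≈ a
  ≈-sym {a} {b} (congruent h) = congruent (p∣-subst (eq a b) (∣m⇒∣-m h))
    where eq : ∀ a b → - (a - b) ≡ b - a
          eq = solve-∀

  ≈-trans : ∀ {a b c} → a ≈ b → b ≈ c → a ≈ c
  ≈-trans {a} {b} {c} (congruent h) (congruent k) = congruent (p∣-subst (eq a b c) (∣m∣n⇒∣m+n h k))
    where eq : ∀ a b c → (a - b) + (b - c) ≡ a - c
          eq = solve-∀

  ≈-isEquivalence : IsEquivalence _≈_
  ≈-isEquivalence = record { refl = ≈-refl ; sym = ≈-sym ; trans = ≈-trans }

  ≈-setoid : Setoid _ _
  ≈-setoid = record { isEquivalence = ≈-isEquivalence }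

  module ≈-Reasoning = SetoidReasoning ≈-setoid

  p∣⇒≈0 : ∀ {a} → + p ∣ a → a ≈ 0ℤ
  p∣⇒≈0 {a} h = congruent (p∣-subst (sym (ℤ.+-identityʳ a)) h)

  ≈0⇒p∣ : ∀ {a} → a ≈ 0ℤ → + p ∣ a
  ≈0⇒p∣ {a} (congruent h) = p∣-subst (ℤ.+-identityʳ a) h

  -≈0⇒≈ : ∀ {a b} → a - b ≈ 0ℤ → a ≈ b
  -≈0⇒≈ a-b≈0 = congruent (≈0⇒p∣ a-b≈0)

  ≈⇒-≈0 : ∀ {a b} → a ≈ b → a - b ≈ 0ℤ
  ≈⇒-≈0 (congruent p∣a-b) = p∣⇒≈0 p∣a-b

  ≈⇒≡[modℤ] : ∀ {a b} → a ≈ b → a ≡ b [modℤ p ]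
  ≈⇒≡[modℤ] (congruent p∣a-b) = ∣⇒∣ᵤ p∣a-b

  ≈-%ℕ : .{{_ : ℕ.NonZero p}} → ∀ a → a ≈ + (a %ℕ p)
  ≈-%ℕ a = congruent (divides (a /ℕ p) (begin
    a - + (a %ℕ p)                                   ≡⟨ cong (_- + (a %ℕ p)) (a≡a%ℕn+[a/ℕn]*n a p) ⟩
    + (a %ℕ p) + (a /ℕ p) * + p - + (a %ℕ p)         ≡⟨ cancel (+ (a %ℕ p)) ((a /ℕ p) * + p) ⟩
    (a /ℕ p) * + p                                   ∎))
    where cancel : ∀ r s → r + s - r ≡ s
          cancel = solve-∀


  +-cong : ∀ {a a′ b b′} → a ≈ a′ → b ≈ b′ → a + b ≈ a′ + b′
  +-cong {a} {a′} {b} {b′} (congruent h) (congruent k) = congruent (p∣-subst (eq a a′ b b′) (∣m∣n⇒∣m+n h k))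
    where eq : ∀ a a′ b b′ → (a - a′) + (b - b′) ≡ (a + b) - (a′ + b′)
          eq = solve-∀

  -‿cong : ∀ {a a′} → a ≈ a′ → - a ≈ - a′
  -‿cong {a} {a′} (congruent h) = congruent (p∣-subst (eq a a′) (∣m⇒∣-m h))
    where eq : ∀ a a′ → - (a - a′) ≡ - a - - a′
          eq = solve-∀

  *-cong : ∀ {a a′ b b′} → a ≈ a′ → b ≈ b′ → a * b ≈ a′ * b′
  *-cong {a} {a′} {b} {b′} (congruent h) (congruent k) =
    congruent (p∣-subst (eq a a′ b b′) (∣m∣n⇒∣m+n (∣n⇒∣m*n a k) (∣m⇒∣m*n b′ h)))
    where eq : ∀ a a′ b b′ → a * (b - b′) + (a - a′) * b′ ≡ a * b - a′ * b′
          eq = solve-∀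

  ^-cong : ∀ {a a′} → a ≈ a′ → ∀ k → a ^ k ≈ a′ ^ k
  ^-cong h zero    = ≈-refl
  ^-cong h (suc k) = *-cong h (^-cong h k)

  signP-cong : ∀ k {a b} → a ≈ b → signP 0 k a ≈ signP 0 k b
  signP-cong zero    a≈b = a≈b
  signP-cong (suc k) a≈b = -‿cong (signP-cong k a≈b)

  sumP-map-cong : ∀ {A : Set} {f g : A → ℤ} → (∀ x → f x ≈ g x) → ∀ xs → sumP 0 (map f xs) ≈ sumP 0 (map g xs)
  sumP-map-cong f≈g []       = ≈-refl
  sumP-map-cong f≈g (x ∷ xs) = +-cong (f≈g x) (sumP-map-cong f≈g xs)

  det-cong : ∀ m {M N : Fin m → Fin m → ℤ} → (∀ i j → M i j ≈ N i j) → det 0 m M ≈ det 0 m N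
  det-cong zero    M≈N = ≈-refl
  det-cong (suc m) M≈N = sumP-map-cong
    (λ j → signP-cong (toℕ j) (*-cong (M≈N Fin.zero j) (det-cong m (λ a b → M≈N (Fin.suc a) (punchIn j b)))))
    (allFin (suc m))

  <⇒≉ : ∀ {i j} → i ℕ.< j → j ℕ.< p → ¬ + i ≈ + j
  <⇒≉ {i} {j} i<j j<p (congruent p∣i-j) = ℕ.<⇒≱ (ℕ.≤-<-trans (ℕ.m∸n≤m j i) j<p) (ℕ.∣⇒≤ p∣j∸i)
    where
    p∣j∸i : p ℕ.∣ j ∸ i
    p∣j∸i = subst (p ℕ.∣_) (trans (cong ∣_∣ (ℤ.m-n≡m⊖n i j)) (ℤ.∣⊖∣-< i<j)) (∣⇒∣ᵤ p∣i-j)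
    instance
      j∸i-nonZero : ℕ.NonZero (j ∸ i)
      j∸i-nonZero = ℕ.>-nonZero (ℕ.m<n⇒0<n∸m i<j)

  *≈0⇒≈0∨≈0 : Prime p → ∀ x y → x * y ≈ 0ℤ → x ≈ 0ℤ ⊎ y ≈ 0ℤ
  *≈0⇒≈0∨≈0 p-prime x y xy≈0
    with euclidsLemma ∣ x ∣ ∣ y ∣ p-prime (subst (p ℕ.∣_) (ℤ.abs-* x y) (∣⇒∣ᵤ (≈0⇒p∣ xy≈0)))
  ... | inj₁ p∣x = inj₁ (p∣⇒≈0 (∣ᵤ⇒∣ p∣x))
  ... | inj₂ p∣y = inj₂ (p∣⇒≈0 (∣ᵤ⇒∣ p∣y))

  *-cancelˡ-≈0 : Prime p → ∀ {x y} → ¬ x ≈ 0ℤ → x * y ≈ 0ℤ → y ≈ 0ℤ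
  *-cancelˡ-≈0 p-prime {x} {y} x≉0 xy≈0 with *≈0⇒≈0∨≈0 p-prime x y xy≈0
  ... | inj₁ x≈0 = contradiction x≈0 x≉0
  ... | inj₂ y≈0 = y≈0

  1≉0 : Prime p → ¬ 1ℤ ≈ 0ℤ
  1≉0 p-prime 1≈0 = <⇒≉ {0} {1} (ℕ.s≤s ℕ.z≤n) (ℕ.nonTrivial⇒n>1 p) (≈-sym 1≈0)
    where instance p-nonTrivial = prime⇒nonTrivial p-prime

  prodP-≉0 : Prime p → ∀ {xs} → All (λ x → ¬ x ≈ 0ℤ) xs → ¬ prodP 0 xs ≈ 0ℤ
  prodP-≉0 p-prime []           = 1≉0 p-prime
  prodP-≉0 p-prime {x ∷ xs} (x≉0 ∷ xs≉0) xxs≈0 with *≈0⇒≈0∨≈0 p-prime x (prodP 0 xs) xxs≈0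
  ... | inj₁ x≈0   = x≉0 x≈0
  ... | inj₂ xs≈0  = prodP-≉0 p-prime xs≉0 xs≈0

module Evaluation where

  open import Data.Integer using (ℤ; +_; _+_; _-_; _*_; -_; _^_; 0ℤ; 1ℤ)
  import Data.Integer.Properties as ℤ
  open import Data.Integer.Tactic.RingSolver using (solve-∀)
  open import Data.Fin using (toℕ; punchIn)
  open import Data.List using ([]; _∷_; map; allFin)
  open import Data.List.Properties using (map-∘; map-cong)
  open import Data.List.Relation.Unary.All using ([]; _∷_)
  open import Data.Integer.Divisibility.Signed using (_∣_; divides; ∣ᵤ⇒∣; ∣m∣n⇒∣m+n; ∣n⇒∣m*n)
  open import Function using (_∘_)
  open Relation.Binary.PropositionalEquality.≡-Reasoning

  eval : ∀ n → (Fin n → ℤ) → Poly n → ℤ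
  eval zero    x a        = a
  eval (suc n) x []       = 0ℤ
  eval (suc n) x (c ∷ cs) = eval n (x ∘ Fin.suc) c + x Fin.zero * eval (suc n) x cs

  eval-zeroP : ∀ n x → eval n x (zeroP n) ≡ 0ℤ
  eval-zeroP zero    x = refl
  eval-zeroP (suc n) x = refl

  eval-constP : ∀ n x a → eval n x (constP n a) ≡ a
  eval-constP zero    x a = refl
  eval-constP (suc n) x a = begin
    eval n (x ∘ Fin.suc) (constP n a) + x Fin.zero * 0ℤ
      ≡⟨ cong₂ _+_ (eval-constP n (x ∘ Fin.suc) a) (ℤ.*-zeroʳ (x Fin.zero)) ⟩
    a + 0ℤ
      ≡⟨ ℤ.+-identityʳ a ⟩
    a ∎

  eval-oneP : ∀ n x → eval n x (oneP n) ≡ 1ℤ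
  eval-oneP n x = eval-constP n x 1ℤ

  eval-addP : ∀ n x a b → eval n x (addP n a b) ≡ eval n x a + eval n x b
  eval-addP zero    x a        b        = refl
  eval-addP (suc n) x []       q        = sym (ℤ.+-identityˡ _)
  eval-addP (suc n) x (a ∷ as) []       = sym (ℤ.+-identityʳ _)
  eval-addP (suc n) x (a ∷ as) (b ∷ bs) =
    trans (cong₂ (λ c u → c + x Fin.zero * u) (eval-addP n (x ∘ Fin.suc) a b) (eval-addP (suc n) x as bs))
          (shuffle (eval n x′ a) (eval n x′ b) (x Fin.zero) (eval (suc n) x as) (eval (suc n) x bs))
    where x′ = x ∘ Fin.suc
          shuffle : ∀ a b x u v → a + b + x * (u + v) ≡ a + x * u + (b + x * v)
          shuffle = solve-∀

  eval-negP : ∀ n x a → eval n x (negP n a) ≡ - eval n x a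
  eval-negP zero    x a        = refl
  eval-negP (suc n) x []       = refl
  eval-negP (suc n) x (c ∷ cs) =
    trans (cong₂ (λ c u → c + x Fin.zero * u) (eval-negP n (x ∘ Fin.suc) c) (eval-negP (suc n) x cs))
          (shuffle (eval n (x ∘ Fin.suc) c) (x Fin.zero) (eval (suc n) x cs))
    where shuffle : ∀ a x u → - a + x * - u ≡ - (a + x * u)
          shuffle = solve-∀

  eval-subP : ∀ n x a b → eval n x (subP n a b) ≡ eval n x a - eval n x b
  eval-subP n x a b = trans (eval-addP n x a (negP n b)) (cong (_+_ (eval n x a)) (eval-negP n x b))

  mutual
    eval-map-mulP : ∀ n x c q → eval (suc n) x (map (mulP n c) q) ≡ eval n (x ∘ Fin.suc) c * eval (suc n) x q
    eval-map-mulP n x c []       = sym (ℤ.*-zeroʳ (eval n (x ∘ Fin.suc) c))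
    eval-map-mulP n x c (b ∷ bs) =
      trans (cong₂ (λ c u → c + x Fin.zero * u) (eval-mulP n (x ∘ Fin.suc) c b) (eval-map-mulP n x c bs))
            (shuffle (eval n (x ∘ Fin.suc) c) (eval n (x ∘ Fin.suc) b) (x Fin.zero) (eval (suc n) x bs))
      where shuffle : ∀ c b x u → c * b + x * (c * u) ≡ c * (b + x * u)
            shuffle = solve-∀

    eval-mulP : ∀ n x a b → eval n x (mulP n a b) ≡ eval n x a * eval n x b
    eval-mulP zero    x a        b = refl
    eval-mulP (suc n) x []       q = sym (ℤ.*-zeroˡ (eval (suc n) x q))
    eval-mulP (suc n) x (c ∷ as) q = begin
      eval (suc n) x (addP (suc n) (map (mulP n c) q) (zeroP n ∷ mulP (suc n) as q))
        ≡⟨ eval-addP (suc n) x (map (mulP n c) q) (zeroP n ∷ mulP (suc n) as q) ⟩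
      eval (suc n) x (map (mulP n c) q) + (eval n x′ (zeroP n) + x Fin.zero * eval (suc n) x (mulP (suc n) as q))
        ≡⟨ cong₂ (λ u v → u + (v + x Fin.zero * w)) (eval-map-mulP n x c q) (eval-zeroP n x′) ⟩
      eval n x′ c * eval (suc n) x q + (0ℤ + x Fin.zero * w)
        ≡⟨ cong (λ u → eval n x′ c * eval (suc n) x q + (0ℤ + x Fin.zero * u)) (eval-mulP (suc n) x as q) ⟩
      eval n x′ c * eval (suc n) x q + (0ℤ + x Fin.zero * (eval (suc n) x as * eval (suc n) x q))
        ≡⟨ shuffle (eval n x′ c) (x Fin.zero) (eval (suc n) x as) (eval (suc n) x q) ⟩
      (eval n x′ c + x Fin.zero * eval (suc n) x as) * eval (suc n) x q
        ∎
      where x′ = x ∘ Fin.suc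
            w = eval (suc n) x (mulP (suc n) as q)
            shuffle : ∀ c x u v → c * v + (0ℤ + x * (u * v)) ≡ (c + x * u) * v
            shuffle = solve-∀

  eval-powP : ∀ n x a k → eval n x (powP n a k) ≡ eval n x a ^ k
  eval-powP n x a zero    = eval-oneP n x
  eval-powP n x a (suc k) = trans (eval-mulP n x a (powP n a k)) (cong (eval n x a *_) (eval-powP n x a k))

  eval-sumP : ∀ n x as → eval n x (sumP n as) ≡ sumP 0 (map (eval n x) as)
  eval-sumP n x []       = eval-zeroP n x
  eval-sumP n x (a ∷ as) = trans (eval-addP n x a (sumP n as)) (cong (_+_ (eval n x a)) (eval-sumP n x as))

  eval-prodP : ∀ n x as → eval n x (prodP n as) ≡ prodP 0 (map (eval n x) as)
  eval-prodP n x []       = eval-oneP n x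
  eval-prodP n x (a ∷ as) = trans (eval-mulP n x a (prodP n as)) (cong (eval n x a *_) (eval-prodP n x as))

  eval-signP : ∀ n x k a → eval n x (signP n k a) ≡ signP 0 k (eval n x a)
  eval-signP n x zero    a = refl
  eval-signP n x (suc k) a = trans (eval-negP n x (signP n k a)) (cong -_ (eval-signP n x k a))

  eval-var : ∀ n x i → eval n x (var n i) ≡ x i
  eval-var (suc n) x Fin.zero    = begin
    eval n x′ (zeroP n) + x Fin.zero * (eval n x′ (oneP n) + x Fin.zero * 0ℤ)
      ≡⟨ cong₂ (λ u v → u + x Fin.zero * (v + x Fin.zero * 0ℤ)) (eval-zeroP n x′) (eval-oneP n x′) ⟩
    0ℤ + x Fin.zero * (1ℤ + x Fin.zero * 0ℤ)
      ≡⟨ simplify (x Fin.zero) ⟩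
    x Fin.zero
      ∎
    where x′ = x ∘ Fin.suc
          simplify : ∀ y → 0ℤ + y * (1ℤ + y * 0ℤ) ≡ y
          simplify = solve-∀
  eval-var (suc n) x (Fin.suc i) =
    trans (cong (λ u → u + x Fin.zero * 0ℤ) (eval-var n (x ∘ Fin.suc) i)) (simplify (x (Fin.suc i)) (x Fin.zero))
    where simplify : ∀ y z → y + z * 0ℤ ≡ y
          simplify = solve-∀

  eval-det : ∀ n x m (M : Fin m → Fin m → Poly n) (N : Fin m → Fin m → ℤ) →
             (∀ i j → eval n x (M i j) ≡ N i j) → eval n x (det n m M) ≡ det 0 m N
  eval-det n x zero    M N M≡N = eval-oneP n x
  eval-det n x (suc m) M N M≡N = begin
    eval n x (sumP n (map term (allFin (suc m))))       ≡⟨ eval-sumP n x (map term (allFin (suc m))) ⟩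
    sumP 0 (map (eval n x) (map term (allFin (suc m)))) ≡⟨ cong (sumP 0) (map-∘ {g = eval n x} {f = term} (allFin (suc m))) ⟨
    sumP 0 (map (eval n x ∘ term) (allFin (suc m)))     ≡⟨ cong (sumP 0) (map-cong eval-term (allFin (suc m))) ⟩
    det 0 (suc m) N                                     ∎
    where
    term : Fin (suc m) → Poly n
    term j = signP n (toℕ j) (mulP n (M Fin.zero j) (det n m (λ a b → M (Fin.suc a) (punchIn j b))))
    eval-term : ∀ j → eval n x (term j) ≡
                signP 0 (toℕ j) (N Fin.zero j * det 0 m (λ a b → N (Fin.suc a) (punchIn j b)))
    eval-term j =
      trans (eval-signP n x (toℕ j) _)
            (cong (signP 0 (toℕ j))
                  (trans (eval-mulP n x _ _)
                         (cong₂ _*_ (M≡N Fin.zero j) (eval-det n x m _ _ (λ a b → M≡N (Fin.suc a) (punchIn j b))))))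

  eval-IsZeroP : ∀ p n x q → IsZeroP p n q → + p ∣ eval n x q
  eval-IsZeroP p zero    x a        p∣a        = ∣ᵤ⇒∣ p∣a
  eval-IsZeroP p (suc n) x []       []         = divides 0ℤ refl
  eval-IsZeroP p (suc n) x (c ∷ cs) (pc ∷ pcs) =
    ∣m∣n⇒∣m+n (eval-IsZeroP p n (x ∘ Fin.suc) c pc) (∣n⇒∣m*n (x Fin.zero) (eval-IsZeroP p (suc n) x cs pcs))

  module _ (p : ℕ) where
    open Congruence p

    eval-EqP : ∀ n x {a b} → EqP p n a b → eval n x a ≈ eval n x b
    eval-EqP n x {a} {b} a≡b = congruent (subst (+ p ∣_) (eval-subP n x a b) (eval-IsZeroP p n x (subP n a b) a≡b))

module CoefficientMap {m n : ℕ} (h : Poly m → Poly n)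
    (h-zeroP : h (zeroP m) ≡ zeroP n) (h-oneP : h (oneP m) ≡ oneP n)
    (h-addP : ∀ a b → h (addP m a b) ≡ addP n (h a) (h b))
    (h-negP : ∀ a → h (negP m a) ≡ negP n (h a))
    (h-mulP : ∀ a b → h (mulP m a b) ≡ mulP n (h a) (h b)) where

  open import Data.Integer using (+_; -[1+_])
  open import Data.List using ([]; _∷_; map)

  map-addP : ∀ a b → map h (addP (suc m) a b) ≡ addP (suc n) (map h a) (map h b)
  map-addP []       q        = refl
  map-addP (a ∷ as) []       = refl
  map-addP (a ∷ as) (b ∷ bs) = cong₂ _∷_ (h-addP a b) (map-addP as bs)

  map-negP : ∀ a → map h (negP (suc m) a) ≡ negP (suc n) (map h a)
  map-negP []       = refl
  map-negP (a ∷ as) = cong₂ _∷_ (h-negP a) (map-negP as)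

  map-subP : ∀ a b → map h (subP (suc m) a b) ≡ subP (suc n) (map h a) (map h b)
  map-subP a b = trans (map-addP a (negP (suc m) b)) (cong (addP (suc n) (map h a)) (map-negP b))

  map-map-mulP : ∀ c q → map h (map (mulP m c) q) ≡ map (mulP n (h c)) (map h q)
  map-map-mulP c []       = refl
  map-map-mulP c (b ∷ bs) = cong₂ _∷_ (h-mulP c b) (map-map-mulP c bs)

  map-mulP : ∀ a b → map h (mulP (suc m) a b) ≡ mulP (suc n) (map h a) (map h b)
  map-mulP []       q = refl
  map-mulP (c ∷ as) q =
    trans (map-addP (map (mulP m c) q) (zeroP m ∷ mulP (suc m) as q))
          (cong₂ (addP (suc n)) (map-map-mulP c q) (cong₂ _∷_ h-zeroP (map-mulP as q)))

  map-oneP : map h (oneP (suc m)) ≡ oneP (suc n)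
  map-oneP = cong (_∷ []) h-oneP

  map-powP : ∀ a k → map h (powP (suc m) a k) ≡ powP (suc n) (map h a) k
  map-powP a zero    = map-oneP
  map-powP a (suc k) = trans (map-mulP a (powP (suc m) a k)) (cong (mulP (suc n) (map h a)) (map-powP a k))

  map-prodP : ∀ as → map h (prodP (suc m) as) ≡ prodP (suc n) (map (map h) as)
  map-prodP []       = map-oneP
  map-prodP (a ∷ as) = trans (map-mulP a (prodP (suc m) as)) (cong (mulP (suc n) (map h a)) (map-prodP as))

  coeff-map : ∀ q k → coeff n (map h q) k ≡ h (coeff m q k)
  coeff-map []       k       = sym h-zeroP
  coeff-map (a ∷ as) zero    = refl
  coeff-map (a ∷ as) (suc k) = coeff-map as k

  coeffℤ-map : ∀ q k → coeffℤ n (map h q) k ≡ h (coeffℤ m q k)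
  coeffℤ-map q (+ k)    = coeff-map q k
  coeffℤ-map q -[1+ k ] = sym h-zeroP

module Univariate where

  open import Data.Nat using (_<_; z≤n; s≤s)
  import Data.Nat as ℕ
  import Data.Nat.Properties as ℕ
  open import Data.Nat.Combinatorics using (_C_; nCk+nC[k+1]≡[n+1]C[k+1])
  open import Data.Integer using (ℤ; +_; _+_; _-_; _*_; -_; _^_; 0ℤ; 1ℤ; -1ℤ)
  import Data.Integer.Properties as ℤ
  open import Data.Integer.Tactic.RingSolver using (solve-∀)
  open import Data.List using ([]; _∷_; map; drop; length)
  open import Data.List.Relation.Unary.All using (All; []; _∷_)
  open import Data.Product using (_×_; _,_; proj₁; proj₂)
  open import Data.Empty using (⊥-elim)
  open import Relation.Binary.PropositionalEquality using (_≢_)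
  open Relation.Binary.PropositionalEquality.≡-Reasoning
  open Evaluation using (eval)

  evalAt : ℤ → Poly 1 → ℤ
  evalAt b = eval 1 (λ _ → b)

  coeff-addP : ∀ a b k → coeff 0 (addP 1 a b) k ≡ coeff 0 a k + coeff 0 b k
  coeff-addP []       q        k       = sym (ℤ.+-identityˡ _)
  coeff-addP (a ∷ as) []       k       = sym (ℤ.+-identityʳ _)
  coeff-addP (a ∷ as) (b ∷ bs) zero    = refl
  coeff-addP (a ∷ as) (b ∷ bs) (suc k) = coeff-addP as bs k

  coeff-negP : ∀ a k → coeff 0 (negP 1 a) k ≡ - coeff 0 a k
  coeff-negP []       k       = refl
  coeff-negP (a ∷ as) zero    = refl
  coeff-negP (a ∷ as) (suc k) = coeff-negP as k

  coeff-subP : ∀ a b k → coeff 0 (subP 1 a b) k ≡ coeff 0 a k - coeff 0 b k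
  coeff-subP a b k = trans (coeff-addP a (negP 1 b) k) (cong (_+_ (coeff 0 a k)) (coeff-negP b k))

  coeff-scale : ∀ c q k → coeff 0 (map (c *_) q) k ≡ c * coeff 0 q k
  coeff-scale c []       k       = sym (ℤ.*-zeroʳ c)
  coeff-scale c (b ∷ bs) zero    = refl
  coeff-scale c (b ∷ bs) (suc k) = coeff-scale c bs k

  coeff-mulP-∷ : ∀ c as q k → coeff 0 (mulP 1 (c ∷ as) q) k ≡ c * coeff 0 q k + coeff 0 (0ℤ ∷ mulP 1 as q) k
  coeff-mulP-∷ c as q k = trans (coeff-addP (map (c *_) q) (0ℤ ∷ mulP 1 as q) k)
                                (cong (_+ coeff 0 (0ℤ ∷ mulP 1 as q) k) (coeff-scale c q k))

  coeff-drop : ∀ k (cs : Poly 1) j → coeff 0 (drop k cs) j ≡ coeff 0 cs (k ℕ.+ j)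
  coeff-drop zero    cs       j = refl
  coeff-drop (suc k) []       j = refl
  coeff-drop (suc k) (c ∷ cs) j = coeff-drop k cs j

  monomial : ℕ → Poly 1
  monomial zero    = 1ℤ ∷ []
  monomial (suc m) = 0ℤ ∷ monomial m

  coeff-monomial-≡ : ∀ m → coeff 0 (monomial m) m ≡ 1ℤ
  coeff-monomial-≡ zero    = refl
  coeff-monomial-≡ (suc m) = coeff-monomial-≡ m

  coeff-monomial-≢ : ∀ m k → k ≢ m → coeff 0 (monomial m) k ≡ 0ℤ
  coeff-monomial-≢ zero    zero    k≢m = ⊥-elim (k≢m refl)
  coeff-monomial-≢ zero    (suc k) k≢m = refl
  coeff-monomial-≢ (suc m) zero    k≢m = refl
  coeff-monomial-≢ (suc m) (suc k) k≢m = coeff-monomial-≢ m k (λ k≡m → k≢m (cong suc k≡m))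

  evalAt-monomial : ∀ b m → evalAt b (monomial m) ≡ b ^ m
  evalAt-monomial b zero    = trans (cong (_+_ 1ℤ) (ℤ.*-zeroʳ b)) (ℤ.+-identityʳ 1ℤ)
  evalAt-monomial b (suc m) = trans (ℤ.+-identityˡ _) (cong (b *_) (evalAt-monomial b m))

  shift : ℕ → (ℕ → ℤ) → ℕ → ℤ
  shift zero    f k       = f k
  shift (suc m) f zero    = 0ℤ
  shift (suc m) f (suc k) = shift m f k

  shift-+ : ∀ m f k → shift m f (m ℕ.+ k) ≡ f k
  shift-+ zero    f k = refl
  shift-+ (suc m) f k = shift-+ m f k

  shift-< : ∀ {n} f → (∀ k → k < n → f k ≡ 0ℤ) → ∀ m k → k < m ℕ.+ n → shift m f k ≡ 0ℤ
  shift-< f f≡0 zero    k       k<n       = f≡0 k k<n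
  shift-< f f≡0 (suc m) zero    _         = refl
  shift-< f f≡0 (suc m) (suc k) (s≤s k<m+n) = shift-< f f≡0 m k k<m+n

  coeff-mulP-monomial : ∀ m q k → coeff 0 (mulP 1 (monomial m) q) k ≡ shift m (coeff 0 q) k
  coeff-mulP-monomial zero q k = begin
    coeff 0 (mulP 1 (monomial 0) q) k          ≡⟨ coeff-mulP-∷ 1ℤ [] q k ⟩
    1ℤ * coeff 0 q k + coeff 0 (0ℤ ∷ []) k     ≡⟨ cong (_+_ (1ℤ * coeff 0 q k)) (coeff-zero k) ⟩
    1ℤ * coeff 0 q k + 0ℤ                      ≡⟨ ℤ.+-identityʳ _ ⟩
    1ℤ * coeff 0 q k                           ≡⟨ ℤ.*-identityˡ _ ⟩
    coeff 0 q k                                ∎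
    where coeff-zero : ∀ k → coeff 0 (0ℤ ∷ []) k ≡ 0ℤ
          coeff-zero zero    = refl
          coeff-zero (suc k) = refl
  coeff-mulP-monomial (suc m) q zero    = trans (coeff-mulP-∷ 0ℤ (monomial m) q 0) (ℤ.+-identityʳ _)
  coeff-mulP-monomial (suc m) q (suc k) =
    trans (coeff-mulP-∷ 0ℤ (monomial m) q (suc k)) (trans (ℤ.+-identityˡ _) (coeff-mulP-monomial m q k))

  linear : ℤ → Poly 1
  linear a = subP 1 (var 1 Fin.zero) (constP 1 a)

  evalAt-linear : ∀ b a → evalAt b (linear a) ≡ b - a
  evalAt-linear b a = simplify b a
    where simplify : ∀ b a → 0ℤ + - a + b * (1ℤ + b * 0ℤ) ≡ b - a
          simplify = solve-∀

  Monic : ℕ → Poly 1 → Set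
  Monic m a = coeff 0 a m ≡ 1ℤ × (∀ k → m < k → coeff 0 a k ≡ 0ℤ)

  coeff-mulP-zeroˡ : ∀ a b → (∀ k → coeff 0 a k ≡ 0ℤ) → ∀ k → coeff 0 (mulP 1 a b) k ≡ 0ℤ
  coeff-mulP-zeroˡ []       b a≡0 k = refl
  coeff-mulP-zeroˡ (c ∷ as) b a≡0 k = begin
    coeff 0 (mulP 1 (c ∷ as) b) k                    ≡⟨ coeff-mulP-∷ c as b k ⟩
    c * coeff 0 b k + coeff 0 (0ℤ ∷ mulP 1 as b) k   ≡⟨ cong₂ _+_ (cong (_* coeff 0 b k) (a≡0 0)) (tail≡0 k) ⟩
    0ℤ                                               ∎
    where tail≡0 : ∀ k → coeff 0 (0ℤ ∷ mulP 1 as b) k ≡ 0ℤ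
          tail≡0 zero    = refl
          tail≡0 (suc k) = coeff-mulP-zeroˡ as b (λ k → a≡0 (suc k)) k

  monic-mulP : ∀ m n a b → Monic m a → Monic n b → Monic (m ℕ.+ n) (mulP 1 a b)
  monic-mulP m       n []       b (() , _)
  monic-mulP zero    n (c ∷ as) b (c≡1 , as≡0) (b-lead , b-high) =
    trans (same-coeffs n) b-lead , λ k n<k → trans (same-coeffs k) (b-high k n<k)
    where
    same-coeffs : ∀ k → coeff 0 (mulP 1 (c ∷ as) b) k ≡ coeff 0 b k
    same-coeffs k = begin
      coeff 0 (mulP 1 (c ∷ as) b) k                    ≡⟨ coeff-mulP-∷ c as b k ⟩
      c * coeff 0 b k + coeff 0 (0ℤ ∷ mulP 1 as b) k   ≡⟨ cong₂ _+_ (cong (_* coeff 0 b k) c≡1) (tail≡0 k) ⟩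
      1ℤ * coeff 0 b k + 0ℤ                            ≡⟨ ℤ.+-identityʳ _ ⟩
      1ℤ * coeff 0 b k                                 ≡⟨ ℤ.*-identityˡ _ ⟩
      coeff 0 b k                                      ∎
      where tail≡0 : ∀ k → coeff 0 (0ℤ ∷ mulP 1 as b) k ≡ 0ℤ
            tail≡0 zero    = refl
            tail≡0 (suc k) = coeff-mulP-zeroˡ as b (λ k → as≡0 (suc k) (s≤s z≤n)) k
  monic-mulP (suc m) n (c ∷ as) b (a-lead , a-high) (b-lead , b-high) = lead , high
    where
    ih : Monic (m ℕ.+ n) (mulP 1 as b)
    ih = monic-mulP m n as b (a-lead , λ k m<k → a-high (suc k) (s≤s m<k)) (b-lead , b-high)
    b-high′ : ∀ k → m ℕ.+ n ℕ.≤ k → coeff 0 b (suc k) ≡ 0ℤ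
    b-high′ k m+n≤k = b-high (suc k) (s≤s (ℕ.≤-trans (ℕ.m≤n+m n m) m+n≤k))
    lead : coeff 0 (mulP 1 (c ∷ as) b) (suc (m ℕ.+ n)) ≡ 1ℤ
    lead = begin
      coeff 0 (mulP 1 (c ∷ as) b) (suc (m ℕ.+ n))         ≡⟨ coeff-mulP-∷ c as b (suc (m ℕ.+ n)) ⟩
      c * coeff 0 b (suc (m ℕ.+ n)) + coeff 0 (mulP 1 as b) (m ℕ.+ n)
        ≡⟨ cong₂ (λ u v → c * u + v) (b-high′ (m ℕ.+ n) ℕ.≤-refl) (proj₁ ih) ⟩
      c * 0ℤ + 1ℤ                                           ≡⟨ cong (_+ 1ℤ) (ℤ.*-zeroʳ c) ⟩
      1ℤ                                                    ∎
    high : ∀ k → suc (m ℕ.+ n) < k → coeff 0 (mulP 1 (c ∷ as) b) k ≡ 0ℤ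
    high (suc k) (s≤s m+n<k) = begin
      coeff 0 (mulP 1 (c ∷ as) b) (suc k)                   ≡⟨ coeff-mulP-∷ c as b (suc k) ⟩
      c * coeff 0 b (suc k) + coeff 0 (mulP 1 as b) k
        ≡⟨ cong₂ (λ u v → c * u + v) (b-high′ k (ℕ.<⇒≤ m+n<k)) (proj₂ ih k m+n<k) ⟩
      c * 0ℤ + 0ℤ                                           ≡⟨ cong (_+ 0ℤ) (ℤ.*-zeroʳ c) ⟩
      0ℤ                                                    ∎

  monic-prodP : ∀ {as} → All (Monic 1) as → Monic (length as) (prodP 1 as)
  monic-prodP []                        = refl , λ { (suc k) _ → refl }
  monic-prodP {a ∷ as} (a-monic ∷ monics) = monic-mulP 1 (length as) a (prodP 1 as) a-monic (monic-prodP monics)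

  monic-linear : ∀ a → Monic 1 (linear a)
  monic-linear a = refl , λ { (suc zero) (s≤s ()) ; (suc (suc k)) _ → refl }

  X^[q+2]-X : ℕ → Poly 1
  X^[q+2]-X q = 0ℤ ∷ -1ℤ ∷ monomial q

  monic-X^[q+2]-X : ∀ q → Monic (suc (suc q)) (X^[q+2]-X q)
  monic-X^[q+2]-X q = coeff-monomial-≡ q ,
    λ { (suc (suc k)) (s≤s (s≤s q<k)) → coeff-monomial-≢ q k (λ k≡q → ℕ.<⇒≢ q<k (sym k≡q)) }

  evalAt-X^[q+2]-X : ∀ b q → evalAt b (X^[q+2]-X q) ≡ b ^ suc (suc q) - b
  evalAt-X^[q+2]-X b q = trans (cong (λ u → 0ℤ + b * (-1ℤ + b * u)) (evalAt-monomial b q)) (expand b (b ^ q))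
    where expand : ∀ b y → 0ℤ + b * (-1ℤ + b * y) ≡ b * (b * y) - b
          expand = solve-∀

  1+X : Poly 1
  1+X = 1ℤ ∷ 1ℤ ∷ []

  coeff-powP-1+X : ∀ n k → coeff 0 (powP 1 1+X n) k ≡ + (n C k)
  coeff-powP-1+X zero    zero    = refl
  coeff-powP-1+X zero    (suc k) = refl
  coeff-powP-1+X (suc n) zero    = begin
    coeff 0 (powP 1 1+X (suc n)) 0      ≡⟨ coeff-mulP-∷ 1ℤ (1ℤ ∷ []) (powP 1 1+X n) 0 ⟩
    1ℤ * coeff 0 (powP 1 1+X n) 0 + 0ℤ  ≡⟨ cong (λ c → 1ℤ * c + 0ℤ) (coeff-powP-1+X n 0) ⟩
    1ℤ                                  ∎
  coeff-powP-1+X (suc n) (suc k) = begin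
    coeff 0 (powP 1 1+X (suc n)) (suc k)
      ≡⟨ coeff-mulP-∷ 1ℤ (monomial 0) (powP 1 1+X n) (suc k) ⟩
    1ℤ * coeff 0 (powP 1 1+X n) (suc k) + coeff 0 (mulP 1 (monomial 0) (powP 1 1+X n)) k
      ≡⟨ cong₂ (λ u v → 1ℤ * u + v) (coeff-powP-1+X n (suc k))
                                    (trans (coeff-mulP-monomial 0 (powP 1 1+X n) k) (coeff-powP-1+X n k)) ⟩
    1ℤ * + (n C suc k) + + (n C k)
      ≡⟨ cong (_+ + (n C k)) (ℤ.*-identityˡ (+ (n C suc k))) ⟩
    + (n C suc k) + + (n C k)
      ≡⟨ ℤ.pos-+ (n C suc k) (n C k) ⟨
    + (n C suc k ℕ.+ n C k)
      ≡⟨ cong +_ (trans (ℕ.+-comm (n C suc k) (n C k)) (nCk+nC[k+1]≡[n+1]C[k+1] n k)) ⟩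
    + (suc n C suc k)
      ∎

  -- quotient a cs is the quotient of c + x·cs by x − a, for every constant term c.
  quotient : ℤ → Poly 1 → Poly 1
  quotient a []       = []
  quotient a (d ∷ ds) = evalAt a (d ∷ ds) ∷ quotient a ds

  evalAt-quotient : ∀ a b c cs → evalAt b (c ∷ cs) ≡ (b - a) * evalAt b (quotient a cs) + evalAt a (c ∷ cs)
  evalAt-quotient a b c []       = identity a b c
    where identity : ∀ a b c → c + b * 0ℤ ≡ (b - a) * 0ℤ + (c + a * 0ℤ)
          identity = solve-∀
  evalAt-quotient a b c (d ∷ ds) = begin
    c + b * evalAt b (d ∷ ds)
      ≡⟨ cong (λ u → c + b * u) (evalAt-quotient a b d ds) ⟩
    c + b * ((b - a) * evalAt b (quotient a ds) + evalAt a (d ∷ ds))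
      ≡⟨ identity a b c (evalAt b (quotient a ds)) (evalAt a (d ∷ ds)) ⟩
    (b - a) * (evalAt a (d ∷ ds) + b * evalAt b (quotient a ds)) + (c + a * evalAt a (d ∷ ds)) ∎
    where identity : ∀ a b c u e → c + b * ((b - a) * u + e) ≡ (b - a) * (e + b * u) + (c + a * e)
          identity = solve-∀

  evalAt-difference : ∀ a b c cs → evalAt b (c ∷ cs) - evalAt a (c ∷ cs) ≡ (b - a) * evalAt b (quotient a cs)
  evalAt-difference a b c cs = trans (cong (_- evalAt a (c ∷ cs)) (evalAt-quotient a b c cs))
                                     (cancel (b - a) (evalAt b (quotient a cs)) (evalAt a (c ∷ cs)))
    where cancel : ∀ x y z → x * y + z - z ≡ x * y
          cancel = solve-∀

  coeff-quotient : ∀ a cs k → coeff 0 (quotient a cs) k ≡ evalAt a (drop k cs)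
  coeff-quotient a []       zero    = refl
  coeff-quotient a []       (suc k) = refl
  coeff-quotient a (d ∷ ds) zero    = refl
  coeff-quotient a (d ∷ ds) (suc k) = coeff-quotient a ds k

module PolyCongruence (p : ℕ) where

  open import Data.Integer using (_*_; 0ℤ)
  import Data.Integer.Properties as ℤ
  open import Data.List using ([]; _∷_)
  open Evaluation using (eval-subP)
  open Congruence p
  open Univariate

  infix 4 _≋_
  record _≋_ (a b : Poly 1) : Set where
    constructor coeffwise
    field coeff-≈ : ∀ k → coeff 0 a k ≈ coeff 0 b k
  open _≋_ public

  ≋-refl : ∀ {a} → a ≋ a
  ≋-refl = coeffwise λ k → ≈-refl

  ≋-sym : ∀ {a b} → a ≋ b → b ≋ a
  ≋-sym a≋b = coeffwise λ k → ≈-sym (coeff-≈ a≋b k)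

  ≋-trans : ∀ {a b c} → a ≋ b → b ≋ c → a ≋ c
  ≋-trans a≋b b≋c = coeffwise λ k → ≈-trans (coeff-≈ a≋b k) (coeff-≈ b≋c k)

  subP≋0⇒≋ : ∀ {a b} → subP 1 a b ≋ [] → a ≋ b
  subP≋0⇒≋ {a} {b} a-b≋0 = coeffwise λ k → -≈0⇒≈ (subst (_≈ 0ℤ) (coeff-subP a b k) (coeff-≈ a-b≋0 k))

  mulP-zeroˡ : ∀ a b → a ≋ [] → mulP 1 a b ≋ []
  mulP-zeroˡ []       b a≋0 = ≋-refl
  mulP-zeroˡ (c ∷ as) b a≋0 = coeffwise λ k →
    subst (_≈ 0ℤ) (sym (coeff-mulP-∷ c as b k))
          (+-cong (*-cong (coeff-≈ a≋0 0) (≈-refl {coeff 0 b k})) (tail≋0 k))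
    where tail≋0 : ∀ k → coeff 0 (0ℤ ∷ mulP 1 as b) k ≈ 0ℤ
          tail≋0 zero    = ≈-refl
          tail≋0 (suc k) = coeff-≈ (mulP-zeroˡ as b (coeffwise λ k → coeff-≈ a≋0 (suc k))) k

  mulP-congʳ : ∀ a {b b′} → b ≋ b′ → mulP 1 a b ≋ mulP 1 a b′
  mulP-congʳ []       b≋b′ = ≋-refl
  mulP-congʳ (c ∷ as) {b} {b′} b≋b′ = coeffwise λ k →
    subst₂ _≈_ (sym (coeff-mulP-∷ c as b k)) (sym (coeff-mulP-∷ c as b′ k))
           (+-cong (*-cong (≈-refl {c}) (coeff-≈ b≋b′ k)) (tail≈ k))
    where tail≈ : ∀ k → coeff 0 (0ℤ ∷ mulP 1 as b) k ≈ coeff 0 (0ℤ ∷ mulP 1 as b′) k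
          tail≈ zero    = ≈-refl
          tail≈ (suc k) = coeff-≈ (mulP-congʳ as b≋b′) k

  mulP-congˡ : ∀ {a a′} b → a ≋ a′ → mulP 1 a b ≋ mulP 1 a′ b
  mulP-congˡ {[]}     {[]}       b a≋a′ = ≋-refl
  mulP-congˡ {[]}     {c′ ∷ as′} b a≋a′ = ≋-sym (mulP-zeroˡ (c′ ∷ as′) b (≋-sym a≋a′))
  mulP-congˡ {c ∷ as} {[]}       b a≋a′ = mulP-zeroˡ (c ∷ as) b a≋a′
  mulP-congˡ {c ∷ as} {c′ ∷ as′} b a≋a′ = coeffwise λ k →
    subst₂ _≈_ (sym (coeff-mulP-∷ c as b k)) (sym (coeff-mulP-∷ c′ as′ b k))
           (+-cong (*-cong (coeff-≈ a≋a′ 0) (≈-refl {coeff 0 b k})) (tail≈ k))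
    where tail≈ : ∀ k → coeff 0 (0ℤ ∷ mulP 1 as b) k ≈ coeff 0 (0ℤ ∷ mulP 1 as′ b) k
          tail≈ zero    = ≈-refl
          tail≈ (suc k) = coeff-≈ (mulP-congˡ {as} {as′} b (coeffwise λ k → coeff-≈ a≋a′ (suc k))) k

  powP-cong : ∀ {a a′} → a ≋ a′ → ∀ k → powP 1 a k ≋ powP 1 a′ k
  powP-cong a≋a′ zero    = ≋-refl
  powP-cong {a} {a′} a≋a′ (suc k) = ≋-trans (mulP-congˡ (powP 1 a k) a≋a′) (mulP-congʳ a′ (powP-cong a≋a′ k))

  evalAt-≋0 : ∀ b a → a ≋ [] → evalAt b a ≈ 0ℤ
  evalAt-≋0 b []       a≋0 = ≈-refl
  evalAt-≋0 b (c ∷ cs) a≋0 = ≈-trans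
    (+-cong (coeff-≈ a≋0 0) (*-cong (≈-refl {b}) (evalAt-≋0 b cs (coeffwise λ k → coeff-≈ a≋0 (suc k)))))
    (≈-reflexive (trans (ℤ.+-identityˡ (b * 0ℤ)) (ℤ.*-zeroʳ b)))

  evalAt-cong : ∀ b {a a′} → a ≋ a′ → evalAt b a ≈ evalAt b a′
  evalAt-cong b {a} {a′} a≋a′ = -≈0⇒≈ (subst (_≈ 0ℤ) (eval-subP 1 (λ _ → b) a a′)
    (evalAt-≋0 b (subP 1 a a′) (coeffwise λ k → subst (_≈ 0ℤ) (sym (coeff-subP a a′ k)) (≈⇒-≈0 (coeff-≈ a≋a′ k)))))

module Roots (p : ℕ) (p-prime : Prime p) where

  open import Data.Nat using (_≤_; _<_; z≤n; s≤s)
  import Data.Nat as ℕ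
  import Data.Nat.Properties as ℕ
  open import Data.Integer using (+_; _+_; _-_; _*_; -_; 0ℤ)
  open import Data.Integer.Tactic.RingSolver using (solve-∀)
  open import Data.List using ([]; _∷_; drop)
  open Congruence p
  open Univariate
  open PolyCongruence p

  private
    quotient-high : ∀ m a c cs → (∀ k → suc m ≤ k → coeff 0 (c ∷ cs) k ≈ 0ℤ) →
                    ∀ k → m ≤ k → coeff 0 (quotient a cs) k ≈ 0ℤ
    quotient-high m a c cs g-high k m≤k = subst (_≈ 0ℤ) (sym (coeff-quotient a cs k))
      (evalAt-≋0 a (drop k cs) (coeffwise λ j → subst (_≈ 0ℤ) (sym (coeff-drop k cs j))
        (g-high (suc (k ℕ.+ j)) (s≤s (ℕ.≤-trans m≤k (ℕ.m≤m+n k j))))))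

    quotient-roots : ∀ m c cs → suc m ≤ p → (∀ b → b < suc m → evalAt (+ b) (c ∷ cs) ≈ 0ℤ) →
                     ∀ b → b < m → evalAt (+ b) (quotient (+ m) cs) ≈ 0ℤ
    quotient-roots m c cs m<p roots b b<m = *-cancelˡ-≈0 p-prime (<⇒≉ b<m m<p ∘ -≈0⇒≈)
      (subst (_≈ 0ℤ) (evalAt-difference (+ m) (+ b) c cs)
        (≈⇒-≈0 (≈-trans (roots b (ℕ.m<n⇒m<1+n b<m)) (≈-sym (roots m ℕ.≤-refl)))))

    ≋0-from-quotient : ∀ a c cs → quotient a cs ≋ [] → evalAt a (c ∷ cs) ≈ 0ℤ → (c ∷ cs) ≋ []
    ≋0-from-quotient a c []       q≋0 g[a]≈0 =
      coeffwise λ { zero → ≈-trans (≈-reflexive (sym (identity a c))) g[a]≈0 ; (suc k) → ≈-refl }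
      where identity : ∀ a c → c + a * 0ℤ ≡ c
            identity = solve-∀
    ≋0-from-quotient a c (d ∷ ds) q≋0 g[a]≈0 = coeffwise λ { zero → c≈0 ; (suc k) → coeff-≈ tail≋0 k }
      where
      tail≋0 : (d ∷ ds) ≋ []
      tail≋0 = ≋0-from-quotient a d ds (coeffwise λ k → coeff-≈ q≋0 (suc k)) (coeff-≈ q≋0 0)
      c≈0 : c ≈ 0ℤ
      c≈0 = begin
        c                                                  ≡⟨ identity a c (evalAt a (d ∷ ds)) ⟩
        evalAt a (c ∷ d ∷ ds) + - (a * evalAt a (d ∷ ds))
          ≈⟨ +-cong g[a]≈0 (-‿cong (*-cong (≈-refl {a}) (coeff-≈ q≋0 0))) ⟩
        0ℤ + - (a * 0ℤ)                                    ≡⟨ zero-identity a ⟩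
        0ℤ                                                 ∎
        where open ≈-Reasoning
              identity : ∀ a c e → c ≡ (c + a * e) + - (a * e)
              identity = solve-∀
              zero-identity : ∀ a → 0ℤ + - (a * 0ℤ) ≡ 0ℤ
              zero-identity = solve-∀

  vanishing : ∀ n → n ≤ p → ∀ g → (∀ k → n ≤ k → coeff 0 g k ≈ 0ℤ) →
              (∀ b → b < n → evalAt (+ b) g ≈ 0ℤ) → g ≋ []
  vanishing zero    _   g        g-high _     = coeffwise λ k → g-high k z≤n
  vanishing (suc m) _   []       _      _     = ≋-refl
  vanishing (suc m) n≤p (c ∷ cs) g-high roots = ≋0-from-quotient (+ m) c cs
    (vanishing m (ℕ.≤-trans (ℕ.n≤1+n m) n≤p) (quotient (+ m) cs)
               (quotient-high m (+ m) c cs g-high) (quotient-roots m c cs n≤p roots))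
    (roots m ℕ.≤-refl)

module Binomial where

  open import Data.Nat using (_+_; _*_; z≤n; s≤s)
  import Data.Nat.Properties as ℕ
  open import Data.Nat.Combinatorics using (_C_; nC1≡n; nCk+nC[k+1]≡[n+1]C[k+1]; k>n⇒nCk≡0)
  open import Data.Nat.Tactic.RingSolver using (solve-∀)
  open Relation.Binary.PropositionalEquality.≡-Reasoning

  [k+1]*[n+1]C[k+1]≡[n+1]*nCk : ∀ n k → suc k * (suc n C suc k) ≡ suc n * (n C k)
  [k+1]*[n+1]C[k+1]≡[n+1]*nCk zero    zero    = refl
  [k+1]*[n+1]C[k+1]≡[n+1]*nCk zero    (suc k) = begin
    suc (suc k) * (1 C suc (suc k)) ≡⟨ cong (suc (suc k) *_) (k>n⇒nCk≡0 {1} {suc (suc k)} (s≤s (s≤s z≤n))) ⟩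
    suc (suc k) * 0                 ≡⟨ ℕ.*-zeroʳ (suc (suc k)) ⟩
    0                               ≡⟨ cong (1 *_) (k>n⇒nCk≡0 {0} {suc k} (s≤s z≤n)) ⟨
    1 * (0 C suc k)                 ∎
  [k+1]*[n+1]C[k+1]≡[n+1]*nCk (suc n) zero    = begin
    1 * (suc (suc n) C 1) ≡⟨ ℕ.*-identityˡ _ ⟩
    suc (suc n) C 1       ≡⟨ nC1≡n (suc (suc n)) ⟩
    suc (suc n)           ≡⟨ ℕ.*-identityʳ (suc (suc n)) ⟨
    suc (suc n) * 1       ∎
  [k+1]*[n+1]C[k+1]≡[n+1]*nCk (suc n) (suc k) = begin
    suc (suc k) * (suc (suc n) C suc (suc k))
      ≡⟨ cong (suc (suc k) *_) (nCk+nC[k+1]≡[n+1]C[k+1] (suc n) (suc k)) ⟨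
    suc (suc k) * (a + b)
      ≡⟨ distribute k a b ⟩
    a + suc k * a + suc (suc k) * b
      ≡⟨ cong₂ (λ x y → a + x + y) ([k+1]*[n+1]C[k+1]≡[n+1]*nCk n k) ([k+1]*[n+1]C[k+1]≡[n+1]*nCk n (suc k)) ⟩
    a + suc n * (n C k) + suc n * (n C suc k)
      ≡⟨ collect a (suc n) (n C k) (n C suc k) ⟩
    a + suc n * (n C k + n C suc k)
      ≡⟨ cong (λ z → a + suc n * z) (nCk+nC[k+1]≡[n+1]C[k+1] n k) ⟩
    suc (suc n) * a
      ∎
    where
    a = suc n C suc k
    b = suc n C suc (suc k)
    distribute : ∀ k a b → suc (suc k) * (a + b) ≡ a + suc k * a + suc (suc k) * b
    distribute = solve-∀
    collect : ∀ a m c d → a + m * c + m * d ≡ a + m * (c + d)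
    collect = solve-∀

module Fermat (n : ℕ) (p-prime : Prime (suc n)) where

  open import Data.Nat using (_<_; s≤s)
  import Data.Nat as ℕ
  import Data.Nat.Properties as ℕ
  open import Data.Nat.Divisibility using (_∣_; divides; ∣⇒≤)
  open import Data.Nat.Primality using (euclidsLemma)
  open import Data.Nat.Combinatorics using (_C_; nCn≡1; k>n⇒nCk≡0; nCk+nC[k+1]≡[n+1]C[k+1])
  import Data.Integer.Properties as ℤ
  open import Data.Integer using (ℤ; +_; _+_; _-_; _*_; _^_; 0ℤ; 1ℤ; -1ℤ)
  open import Data.Integer.DivMod using (_%ℕ_)
  open import Data.Integer.Divisibility.Signed using (∣ᵤ⇒∣)
  open import Data.Integer.Tactic.RingSolver using (solve-∀)
  open import Data.List using (_∷_)
  open import Data.Sum using (inj₁; inj₂)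
  open import Relation.Binary.Definitions using (tri<; tri≈; tri>)
  open import Relation.Nullary using (¬_; contradiction)
  open Evaluation using (eval-powP)
  open Univariate
  open Binomial
  open Congruence (suc n)
  open PolyCongruence (suc n)
  open ≈-Reasoning

  private
    p = suc n

  p∣pC[k+1] : ∀ k → k < n → p ∣ p C suc k
  p∣pC[k+1] k k<n
    with euclidsLemma (suc k) (p C suc k) p-prime
           (divides (n C k) (trans ([k+1]*[n+1]C[k+1]≡[n+1]*nCk n k) (ℕ.*-comm p (n C k))))
  ... | inj₁ p∣k+1 = contradiction (∣⇒≤ p∣k+1) (ℕ.<⇒≱ (s≤s k<n))
  ... | inj₂ p∣pCk = p∣pCk

  powP-1+X≋1+Xᵖ : powP 1 1+X p ≋ 1ℤ ∷ monomial n
  powP-1+X≋1+Xᵖ = coeffwise λ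
    { zero    → ≈-reflexive (coeff-powP-1+X p 0)
    ; (suc k) → subst (_≈ coeff 0 (monomial n) k) (sym (coeff-powP-1+X p (suc k))) (coeff-suc k)
    }
    where
    coeff-suc : ∀ k → + (p C suc k) ≈ coeff 0 (monomial n) k
    coeff-suc k with ℕ.<-cmp k n
    ... | tri< k<n k≢n _ = ≈-trans (p∣⇒≈0 (∣ᵤ⇒∣ (p∣pC[k+1] k k<n))) (≈-reflexive (sym (coeff-monomial-≢ n k k≢n)))
    ... | tri≈ _ refl _ = ≈-reflexive (trans (cong +_ (nCn≡1 p)) (sym (coeff-monomial-≡ n)))
    ... | tri> _ k≢n k>n = ≈-reflexive (trans (cong +_ (k>n⇒nCk≡0 (s≤s k>n))) (sym (coeff-monomial-≢ n k k≢n)))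

  fermat-ℕ : ∀ b → (+ b) ^ p ≈ + b
  fermat-ℕ zero    = ≈-refl
  fermat-ℕ (suc b) = begin
    (+ suc b) ^ p                          ≡⟨ cong (_^ p) (evalAt-1+X b) ⟨
    evalAt (+ b) 1+X ^ p                   ≡⟨ eval-powP 1 (λ _ → + b) 1+X p ⟨
    evalAt (+ b) (powP 1 1+X p)            ≈⟨ evalAt-cong (+ b) powP-1+X≋1+Xᵖ ⟩
    1ℤ + + b * evalAt (+ b) (monomial n)   ≡⟨ cong (λ u → 1ℤ + + b * u) (evalAt-monomial (+ b) n) ⟩
    1ℤ + (+ b) ^ p                         ≈⟨ +-cong (≈-refl {1ℤ}) (fermat-ℕ b) ⟩
    + suc b                                ∎
    where evalAt-1+X : ∀ b → evalAt (+ b) 1+X ≡ + suc b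
          evalAt-1+X b = simplify (+ b)
            where simplify : ∀ x → 1ℤ + x * (1ℤ + x * 0ℤ) ≡ 1ℤ + x
                  simplify = solve-∀

  fermat : ∀ a → a ^ p ≈ a
  fermat a = begin
    a ^ p             ≈⟨ ^-cong (≈-%ℕ a) p ⟩
    (+ (a %ℕ p)) ^ p  ≈⟨ fermat-ℕ (a %ℕ p) ⟩
    + (a %ℕ p)        ≈⟨ ≈-%ℕ a ⟨
    a                 ∎

  fermat-unit : ∀ {a} → ¬ a ≈ 0ℤ → a ^ n ≈ 1ℤ
  fermat-unit {a} a≉0 = -≈0⇒≈ (*-cancelˡ-≈0 p-prime a≉0
    (subst (_≈ 0ℤ) (factor a (a ^ n)) (≈⇒-≈0 (fermat a))))
    where factor : ∀ a b → a * b - a ≡ a * (b - 1ℤ)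
          factor = solve-∀

  -1^[p-1]≈1 : -1ℤ ^ n ≈ 1ℤ
  -1^[p-1]≈1 = fermat-unit (1≉0 p-prime ∘ -‿cong)

  C[p-1,k]≈-1^k : ∀ k → k ℕ.≤ n → + (n C k) ≈ -1ℤ ^ k
  C[p-1,k]≈-1^k zero    _     = ≈-refl
  C[p-1,k]≈-1^k (suc k) k<n = begin
    + (n C suc k)                          ≡⟨ cancel (+ (n C suc k)) (+ (n C k)) ⟩
    + (n C k) + + (n C suc k) - + (n C k)  ≡⟨ cong (_- + (n C k)) (ℤ.pos-+ (n C k) (n C suc k)) ⟨
    + (n C k ℕ.+ n C suc k) - + (n C k)    ≡⟨ cong (λ c → + c - + (n C k)) (nCk+nC[k+1]≡[n+1]C[k+1] n k) ⟩
    + (p C suc k) - + (n C k)              ≈⟨ +-cong (p∣⇒≈0 (∣ᵤ⇒∣ {i = + (p C suc k)} (p∣pC[k+1] k k<n)))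
                                                     (-‿cong (C[p-1,k]≈-1^k k (ℕ.<⇒≤ k<n))) ⟩
    0ℤ - -1ℤ ^ k                           ≡⟨ negate (-1ℤ ^ k) ⟩
    -1ℤ ^ suc k                            ∎
    where
    cancel : ∀ x y → x ≡ y + x - y
    cancel = solve-∀
    negate : ∀ x → 0ℤ - x ≡ -1ℤ * x
    negate = solve-∀

module LinearFactors (q : ℕ) (p-prime : Prime (suc (suc q))) where

  open import Data.Nat using (_≤_; _<_)
  import Data.Nat.Properties as ℕ
  open import Data.Integer using (ℤ; +_; _+_; _-_; _*_; _^_; 0ℤ)
  import Data.Integer.Properties as ℤ
  open import Data.Fin using (toℕ; fromℕ<)
  open import Data.Fin.Properties using (toℕ-fromℕ<)
  open import Data.List using (_∷_; map; allFin)
  open import Data.List.Properties using (length-map; length-tabulate)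
  open import Data.List.Membership.Propositional using (_∈_)
  open import Data.List.Membership.Propositional.Properties using (∈-map⁺; ∈-allFin)
  open import Data.List.Relation.Unary.Any using (here; there)
  import Data.List.Relation.Unary.All as All
  import Data.List.Relation.Unary.All.Properties as All
  open import Data.Product using (proj₁; proj₂)
  open import Data.Sum using (_⊎_; inj₁; inj₂)
  open Evaluation using (eval-prodP; eval-subP)
  open Univariate
  open Congruence (suc (suc q))
  open PolyCongruence (suc (suc q))
  open Roots (suc (suc q)) p-prime
  open Fermat (suc q) p-prime using (fermat-ℕ)

  private
    p = suc (suc q)

  linearFactor : Fin p → Poly 1
  linearFactor i = linear (+ toℕ i)

  linearFactors : Poly 1
  linearFactors = prodP 1 (map linearFactor (allFin p))

  monic-linearFactors : Monic p linearFactors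
  monic-linearFactors =
    subst (λ m → Monic m linearFactors) (trans (length-map linearFactor (allFin p)) (length-tabulate (λ i → i)))
          (monic-prodP (All.map⁺ {f = linearFactor} (All.universal (λ i → monic-linear (+ toℕ i)) (allFin p))))

  prodP-∈-zero : ∀ {x xs} → x ∈ xs → x ≡ 0ℤ → prodP 0 xs ≡ 0ℤ
  prodP-∈-zero (here refl)            refl = refl
  prodP-∈-zero {xs = y ∷ xs} (there x∈xs) x≡0 =
    trans (cong (y *_) (prodP-∈-zero x∈xs x≡0)) (ℤ.*-zeroʳ y)

  evalAt-linearFactors : ∀ {b} → b < p → evalAt (+ b) linearFactors ≡ 0ℤ
  evalAt-linearFactors {b} b<p =
    trans (eval-prodP 1 (λ _ → + b) (map linearFactor (allFin p)))
          (prodP-∈-zero (∈-map⁺ (evalAt (+ b)) (∈-map⁺ linearFactor (∈-allFin (fromℕ< b<p)))) factor≡0)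
    where
    factor≡0 : evalAt (+ b) (linear (+ toℕ (fromℕ< b<p))) ≡ 0ℤ
    factor≡0 = trans (evalAt-linear (+ b) (+ toℕ (fromℕ< b<p)))
                     (trans (cong (λ i → + b - + i) (toℕ-fromℕ< b<p)) (ℤ.+-inverseʳ (+ b)))

  linearFactors≋X^p-X : linearFactors ≋ X^[q+2]-X q
  linearFactors≋X^p-X = subP≋0⇒≋ (vanishing p ℕ.≤-refl (subP 1 linearFactors (X^[q+2]-X q)) high roots)
    where
    high : ∀ k → p ≤ k → coeff 0 (subP 1 linearFactors (X^[q+2]-X q)) k ≈ 0ℤ
    high k p≤k = ≈-reflexive (trans (coeff-subP linearFactors (X^[q+2]-X q) k) (equal-coeffs (ℕ.m≤n⇒m<n∨m≡n p≤k)))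
      where
      equal-coeffs : p < k ⊎ p ≡ k → coeff 0 linearFactors k - coeff 0 (X^[q+2]-X q) k ≡ 0ℤ
      equal-coeffs (inj₁ p<k) = cong₂ _-_ (proj₂ monic-linearFactors k p<k) (proj₂ (monic-X^[q+2]-X q) k p<k)
      equal-coeffs (inj₂ refl) = cong₂ _-_ (proj₁ monic-linearFactors) (proj₁ (monic-X^[q+2]-X q))
    roots : ∀ b → b < p → evalAt (+ b) (subP 1 linearFactors (X^[q+2]-X q)) ≈ 0ℤ
    roots b b<p = begin
      evalAt (+ b) (subP 1 linearFactors (X^[q+2]-X q))
        ≡⟨ eval-subP 1 (λ _ → + b) linearFactors (X^[q+2]-X q) ⟩
      evalAt (+ b) linearFactors - evalAt (+ b) (X^[q+2]-X q)
        ≡⟨ cong₂ _-_ (evalAt-linearFactors b<p) (evalAt-X^[q+2]-X (+ b) q) ⟩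
      0ℤ - ((+ b) ^ p - + b)
        ≈⟨ +-cong (≈-refl {0ℤ}) (-‿cong (≈⇒-≈0 (fermat-ℕ b))) ⟩
      0ℤ ∎
      where open ≈-Reasoning

module PowersOfX^[q+2]-X (q : ℕ) where

  open import Data.Nat using (_<_; s≤s)
  import Data.Nat as ℕ
  import Data.Nat.Properties as ℕ
  import Data.Nat.Tactic.RingSolver as ℕ-Solver
  open import Data.Nat.Combinatorics using (_C_; nCk+nC[k+1]≡[n+1]C[k+1])
  open import Data.Integer using (ℤ; +_; _+_; _-_; _*_; -_; _^_; 0ℤ; 1ℤ; -1ℤ)
  import Data.Integer.Properties as ℤ
  open import Data.Integer.Tactic.RingSolver using (solve-∀)
  open import Data.List using (_∷_)
  open Relation.Binary.PropositionalEquality.≡-Reasoning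
  open Univariate

  private
    t p : ℕ
    t = suc q
    p = suc t

  coeff-mulP-X^[q+2]-X : ∀ r k → coeff 0 (mulP 1 (X^[q+2]-X q) r) k ≡ shift p (coeff 0 r) k - shift 1 (coeff 0 r) k
  coeff-mulP-X^[q+2]-X r zero = trans (coeff-mulP-∷ 0ℤ (-1ℤ ∷ monomial q) r 0) (ℤ.+-identityʳ (0ℤ * coeff 0 r 0))
  coeff-mulP-X^[q+2]-X r (suc zero) = begin
    coeff 0 (mulP 1 (X^[q+2]-X q) r) 1                           ≡⟨ coeff-mulP-∷ 0ℤ (-1ℤ ∷ monomial q) r 1 ⟩
    0ℤ * coeff 0 r 1 + coeff 0 (mulP 1 (-1ℤ ∷ monomial q) r) 0   ≡⟨ ℤ.+-identityˡ _ ⟩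
    coeff 0 (mulP 1 (-1ℤ ∷ monomial q) r) 0                      ≡⟨ coeff-mulP-∷ -1ℤ (monomial q) r 0 ⟩
    -1ℤ * coeff 0 r 0 + 0ℤ                                       ≡⟨ simplify (coeff 0 r 0) ⟩
    0ℤ - coeff 0 r 0                                             ∎
    where simplify : ∀ x → -1ℤ * x + 0ℤ ≡ 0ℤ - x
          simplify = solve-∀
  coeff-mulP-X^[q+2]-X r (suc (suc k)) = begin
    coeff 0 (mulP 1 (X^[q+2]-X q) r) (suc (suc k))
      ≡⟨ coeff-mulP-∷ 0ℤ (-1ℤ ∷ monomial q) r (suc (suc k)) ⟩
    0ℤ * coeff 0 r (suc (suc k)) + coeff 0 (mulP 1 (-1ℤ ∷ monomial q) r) (suc k)
      ≡⟨ ℤ.+-identityˡ _ ⟩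
    coeff 0 (mulP 1 (-1ℤ ∷ monomial q) r) (suc k)
      ≡⟨ coeff-mulP-∷ -1ℤ (monomial q) r (suc k) ⟩
    -1ℤ * coeff 0 r (suc k) + coeff 0 (mulP 1 (monomial q) r) k
      ≡⟨ cong (_+_ (-1ℤ * coeff 0 r (suc k))) (coeff-mulP-monomial q r k) ⟩
    -1ℤ * coeff 0 r (suc k) + shift q (coeff 0 r) k
      ≡⟨ simplify (coeff 0 r (suc k)) (shift q (coeff 0 r) k) ⟩
    shift q (coeff 0 r) k - coeff 0 r (suc k)
      ∎
    where simplify : ∀ x y → -1ℤ * x + y ≡ y - x
          simplify = solve-∀

  coefficient : ℕ → ℕ → ℤ
  coefficient n = coeff 0 (powP 1 (X^[q+2]-X q) n)

  coefficient-suc : ∀ n k → coefficient (suc n) k ≡ shift p (coefficient n) k - shift 1 (coefficient n) k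
  coefficient-suc n = coeff-mulP-X^[q+2]-X (powP 1 (X^[q+2]-X q) n)

  coefficient-below : ∀ n k → k < n → coefficient n k ≡ 0ℤ
  coefficient-below (suc n) k k<1+n = begin
    coefficient (suc n) k                                     ≡⟨ coefficient-suc n k ⟩
    shift p (coefficient n) k - shift 1 (coefficient n) k     ≡⟨ cong₂ _-_ (shift-< (coefficient n) (coefficient-below n) p k k<p+n)
                                                                           (shift-< (coefficient n) (coefficient-below n) 1 k k<1+n) ⟩
    0ℤ                                                        ∎
    where k<p+n : k < p ℕ.+ n
          k<p+n = ℕ.≤-trans k<1+n (s≤s (ℕ.m≤n+m n (suc q)))

  coefficient-off : ∀ n k s → 0 < s → s < t → coefficient n (n ℕ.+ (k ℕ.* t ℕ.+ s)) ≡ 0ℤ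
  coefficient-off zero    k (suc s) _ _ = cong (coefficient 0) (ℕ.+-suc (k ℕ.* t) s)
  coefficient-off (suc n) k s 0<s s<t = begin
    coefficient (suc n) (suc n ℕ.+ (k ℕ.* t ℕ.+ s))
      ≡⟨ coefficient-suc n (suc n ℕ.+ (k ℕ.* t ℕ.+ s)) ⟩
    shift p (coefficient n) (suc n ℕ.+ (k ℕ.* t ℕ.+ s)) - coefficient n (n ℕ.+ (k ℕ.* t ℕ.+ s))
      ≡⟨ cong₂ _-_ (shifted k) (coefficient-off n k s 0<s s<t) ⟩
    0ℤ ∎
    where
    shifted : ∀ k → shift p (coefficient n) (suc n ℕ.+ (k ℕ.* t ℕ.+ s)) ≡ 0ℤ
    shifted zero    = shift-< (coefficient n) (coefficient-below n) p (suc n ℕ.+ s)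
                              (s≤s (s≤s (subst (ℕ._≤ q ℕ.+ n) (ℕ.+-comm s n) (ℕ.+-monoˡ-≤ n (ℕ.s≤s⁻¹ s<t)))))
    shifted (suc k) = begin
      shift p (coefficient n) (suc n ℕ.+ (suc k ℕ.* t ℕ.+ s))     ≡⟨ cong (shift p (coefficient n)) (reassociate n k q s) ⟩
      shift p (coefficient n) (p ℕ.+ (n ℕ.+ (k ℕ.* t ℕ.+ s)))     ≡⟨ shift-+ p (coefficient n) (n ℕ.+ (k ℕ.* t ℕ.+ s)) ⟩
      coefficient n (n ℕ.+ (k ℕ.* t ℕ.+ s))                       ≡⟨ coefficient-off n k s 0<s s<t ⟩
      0ℤ                                                           ∎
      where reassociate : ∀ n k q s → suc n ℕ.+ (suc k ℕ.* suc q ℕ.+ s) ≡ suc (suc q) ℕ.+ (n ℕ.+ (k ℕ.* suc q ℕ.+ s))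
            reassociate = ℕ-Solver.solve-∀

  coefficient-on : ∀ n k → coefficient n (n ℕ.+ k ℕ.* t) ≡ -1ℤ ^ (n ℕ.+ k) * + (n C k)
  coefficient-on zero    zero    = refl
  coefficient-on zero    (suc k) = sym (ℤ.*-zeroʳ (-1ℤ ^ suc k))
  coefficient-on (suc n) zero    = begin
    coefficient (suc n) (suc n ℕ.+ 0)
      ≡⟨ coefficient-suc n (suc n ℕ.+ 0) ⟩
    shift p (coefficient n) (suc n ℕ.+ 0) - coefficient n (n ℕ.+ 0)
      ≡⟨ cong₂ _-_ (shift-< (coefficient n) (coefficient-below n) p (suc n ℕ.+ 0) n+0<p+n) (coefficient-on n 0) ⟩
    0ℤ - -1ℤ ^ (n ℕ.+ 0) * 1ℤ
      ≡⟨ negate (-1ℤ ^ (n ℕ.+ 0)) ⟩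
    -1ℤ * -1ℤ ^ (n ℕ.+ 0) * 1ℤ
      ∎
    where n+0<p+n : suc n ℕ.+ 0 < p ℕ.+ n
          n+0<p+n = s≤s (s≤s (ℕ.≤-trans (ℕ.≤-reflexive (ℕ.+-identityʳ n)) (ℕ.m≤n+m n q)))
          negate : ∀ x → 0ℤ - x * 1ℤ ≡ -1ℤ * x * 1ℤ
          negate = solve-∀
  coefficient-on (suc n) (suc k) = begin
    coefficient (suc n) (suc n ℕ.+ suc k ℕ.* t)
      ≡⟨ coefficient-suc n (suc n ℕ.+ suc k ℕ.* t) ⟩
    shift p (coefficient n) (suc n ℕ.+ suc k ℕ.* t) - coefficient n (n ℕ.+ suc k ℕ.* t)
      ≡⟨ cong (λ i → shift p (coefficient n) i - coefficient n (n ℕ.+ suc k ℕ.* t)) (reassociate n k q) ⟩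
    shift p (coefficient n) (p ℕ.+ (n ℕ.+ k ℕ.* t)) - coefficient n (n ℕ.+ suc k ℕ.* t)
      ≡⟨ cong₂ _-_ (trans (shift-+ p (coefficient n) (n ℕ.+ k ℕ.* t)) (coefficient-on n k)) (coefficient-on n (suc k)) ⟩
    σ (n ℕ.+ k) * + (n C k) - σ (n ℕ.+ suc k) * + (n C suc k)
      ≡⟨ cong (λ m → σ (n ℕ.+ k) * + (n C k) - σ m * + (n C suc k)) (ℕ.+-suc n k) ⟩
    σ (n ℕ.+ k) * + (n C k) - -1ℤ * σ (n ℕ.+ k) * + (n C suc k)
      ≡⟨ collect (σ (n ℕ.+ k)) (+ (n C k)) (+ (n C suc k)) ⟩
    -1ℤ * (-1ℤ * σ (n ℕ.+ k)) * (+ (n C k) + + (n C suc k))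
      ≡⟨ cong₂ (λ m c → -1ℤ * σ m * c) (ℕ.+-suc n k) (ℤ.pos-+ (n C k) (n C suc k)) ⟨
    σ (suc n ℕ.+ suc k) * + (n C k ℕ.+ n C suc k)
      ≡⟨ cong (λ c → σ (suc n ℕ.+ suc k) * + c) (nCk+nC[k+1]≡[n+1]C[k+1] n k) ⟩
    σ (suc n ℕ.+ suc k) * + (suc n C suc k)
      ∎
    where
    σ : ℕ → ℤ
    σ m = -1ℤ ^ m
    reassociate : ∀ n k q → suc n ℕ.+ suc k ℕ.* suc q ≡ suc (suc q) ℕ.+ (n ℕ.+ k ℕ.* suc q)
    reassociate = ℕ-Solver.solve-∀
    collect : ∀ x c d → x * c - -1ℤ * x * d ≡ -1ℤ * (-1ℤ * x) * (c + d)
    collect = solve-∀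

module AntiDiagonal where

  open import Data.Nat using (_∸_)
  import Data.Nat as ℕ
  import Data.Nat.Properties as ℕ
  open import Data.Integer using (ℤ; _+_; _*_; -_; _^_; 0ℤ; 1ℤ; -1ℤ)
  import Data.Integer.Properties as ℤ
  open import Data.Integer.Tactic.RingSolver using (solve-∀)
  open import Data.Fin using (toℕ; fromℕ; punchIn)
  open import Data.Fin.Properties using (toℕ-fromℕ)
  open import Data.List using (tabulate)
  open import Data.List.Properties using (map-tabulate)
  open import Relation.Nullary using (yes; no; contradiction)
  open import Relation.Binary.PropositionalEquality using (_≢_)
  open Relation.Binary.PropositionalEquality.≡-Reasoning
  open Evaluation using (eval-det)

  antiDiagonal : ∀ m → Fin m → Fin m → ℤ
  antiDiagonal m i j with toℕ i ℕ.+ toℕ j ℕ.≟ m ∸ 1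
  ... | yes _ = 1ℤ
  ... | no  _ = 0ℤ

  -- Poly 0 is ℤ, and eval 0 is the identity whatever the (empty) point.
  det-cong-≡ : ∀ m {M N : Fin m → Fin m → ℤ} → (∀ i j → M i j ≡ N i j) → det 0 m M ≡ det 0 m N
  det-cong-≡ m = eval-det 0 (λ ()) m _ _

  signP≡-1^* : ∀ k a → signP 0 k a ≡ -1ℤ ^ k * a
  signP≡-1^* zero    a = sym (ℤ.*-identityˡ a)
  signP≡-1^* (suc k) a = trans (cong -_ (signP≡-1^* k a)) (negate (-1ℤ ^ k) a)
    where negate : ∀ x a → - (x * a) ≡ -1ℤ * x * a
          negate = solve-∀

  sumP-tabulate-last : ∀ n (f : Fin (suc n) → ℤ) → (∀ j → toℕ j ≢ n → f j ≡ 0ℤ) →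
                       sumP 0 (tabulate f) ≡ f (fromℕ n)
  sumP-tabulate-last zero    f f≡0 = ℤ.+-identityʳ (f Fin.zero)
  sumP-tabulate-last (suc n) f f≡0 =
    trans (cong (_+ sumP 0 (tabulate (f ∘ Fin.suc))) (f≡0 Fin.zero λ ()))
          (trans (ℤ.+-identityˡ _)
                 (sumP-tabulate-last n (f ∘ Fin.suc) (λ j j≢n → f≡0 (Fin.suc j) (j≢n ∘ ℕ.suc-injective))))

  antiDiagonal-yes : ∀ m {i j : Fin m} → toℕ i ℕ.+ toℕ j ≡ m ∸ 1 → antiDiagonal m i j ≡ 1ℤ
  antiDiagonal-yes m {i} {j} i+j≡m-1 with toℕ i ℕ.+ toℕ j ℕ.≟ m ∸ 1
  ... | yes _        = refl
  ... | no  i+j≢m-1  = contradiction i+j≡m-1 i+j≢m-1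

  antiDiagonal-no : ∀ m {i j : Fin m} → toℕ i ℕ.+ toℕ j ≢ m ∸ 1 → antiDiagonal m i j ≡ 0ℤ
  antiDiagonal-no m {i} {j} i+j≢m-1 with toℕ i ℕ.+ toℕ j ℕ.≟ m ∸ 1
  ... | yes i+j≡m-1 = contradiction i+j≡m-1 i+j≢m-1
  ... | no  _       = refl

  toℕ-punchIn-fromℕ : ∀ m (b : Fin m) → toℕ (punchIn (fromℕ m) b) ≡ toℕ b
  toℕ-punchIn-fromℕ (suc m) Fin.zero    = refl
  toℕ-punchIn-fromℕ (suc m) (Fin.suc b) = cong suc (toℕ-punchIn-fromℕ m b)

  antiDiagonal-minor : ∀ m (a b : Fin m) → antiDiagonal (suc m) (Fin.suc a) (punchIn (fromℕ m) b) ≡ antiDiagonal m a b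
  antiDiagonal-minor (suc m) a b with toℕ a ℕ.+ toℕ b ℕ.≟ m
  ... | yes a+b≡m = antiDiagonal-yes (suc (suc m)) (cong suc (trans (cong (toℕ a ℕ.+_) (toℕ-punchIn-fromℕ (suc m) b)) a+b≡m))
  ... | no  a+b≢m = antiDiagonal-no (suc (suc m))
                      (λ eq → a+b≢m (trans (cong (toℕ a ℕ.+_) (sym (toℕ-punchIn-fromℕ (suc m) b))) (ℕ.suc-injective eq)))

  det-antiDiagonal-suc : ∀ m → det 0 (suc m) (antiDiagonal (suc m)) ≡ -1ℤ ^ m * det 0 m (antiDiagonal m)
  det-antiDiagonal-suc m = begin
    det 0 (suc m) (antiDiagonal (suc m))          ≡⟨ cong (sumP 0) (map-tabulate (λ j → j) term) ⟩
    sumP 0 (tabulate term)                        ≡⟨ sumP-tabulate-last m term off-diagonal ⟩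
    term (fromℕ m)
      ≡⟨ cong₂ (λ k e → signP 0 k (e * det 0 m (minor (fromℕ m))))
               (toℕ-fromℕ m) (antiDiagonal-yes (suc m) {Fin.zero} {fromℕ m} (toℕ-fromℕ m)) ⟩
    signP 0 m (1ℤ * det 0 m (minor (fromℕ m)))    ≡⟨ cong (signP 0 m) (ℤ.*-identityˡ _) ⟩
    signP 0 m (det 0 m (minor (fromℕ m)))         ≡⟨ cong (signP 0 m) (det-cong-≡ m (antiDiagonal-minor m)) ⟩
    signP 0 m (det 0 m (antiDiagonal m))          ≡⟨ signP≡-1^* m (det 0 m (antiDiagonal m)) ⟩
    -1ℤ ^ m * det 0 m (antiDiagonal m)            ∎
    where
    minor : Fin (suc m) → Fin m → Fin m → ℤ
    minor j a b = antiDiagonal (suc m) (Fin.suc a) (punchIn j b)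
    term : Fin (suc m) → ℤ
    term j = signP 0 (toℕ j) (antiDiagonal (suc m) Fin.zero j * det 0 m (minor j))
    off-diagonal : ∀ j → toℕ j ≢ m → term j ≡ 0ℤ
    off-diagonal j j≢m = begin
      term j
        ≡⟨ cong (λ e → signP 0 (toℕ j) (e * det 0 m (minor j))) (antiDiagonal-no (suc m) {Fin.zero} {j} j≢m) ⟩
      signP 0 (toℕ j) 0ℤ                             ≡⟨ signP≡-1^* (toℕ j) 0ℤ ⟩
      -1ℤ ^ toℕ j * 0ℤ                               ≡⟨ ℤ.*-zeroʳ (-1ℤ ^ toℕ j) ⟩
      0ℤ                                             ∎

  -1^m*-1^m≡1 : ∀ m → -1ℤ ^ m * -1ℤ ^ m ≡ 1ℤ
  -1^m*-1^m≡1 zero    = refl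
  -1^m*-1^m≡1 (suc m) = trans (square (-1ℤ ^ m)) (-1^m*-1^m≡1 m)
    where square : ∀ x → -1ℤ * x * (-1ℤ * x) ≡ x * x
          square = solve-∀

  det-antiDiagonal-2+ : ∀ m → det 0 (2 ℕ.+ m) (antiDiagonal (2 ℕ.+ m)) ≡ - det 0 m (antiDiagonal m)
  det-antiDiagonal-2+ m = begin
    det 0 (2 ℕ.+ m) (antiDiagonal (2 ℕ.+ m))                  ≡⟨ det-antiDiagonal-suc (suc m) ⟩
    -1ℤ ^ suc m * det 0 (suc m) (antiDiagonal (suc m))        ≡⟨ cong (-1ℤ ^ suc m *_) (det-antiDiagonal-suc m) ⟩
    -1ℤ * -1ℤ ^ m * (-1ℤ ^ m * D)                             ≡⟨ regroup (-1ℤ ^ m) D ⟩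
    - (-1ℤ ^ m * -1ℤ ^ m * D)                                 ≡⟨ cong (λ x → - (x * D)) (-1^m*-1^m≡1 m) ⟩
    - (1ℤ * D)                                                ≡⟨ cong -_ (ℤ.*-identityˡ D) ⟩
    - D                                                       ∎
    where D = det 0 m (antiDiagonal m)
          regroup : ∀ x d → -1ℤ * x * (x * d) ≡ - (x * x * d)
          regroup = solve-∀

  det-antiDiagonal-4* : ∀ k r → det 0 (k ℕ.* 4 ℕ.+ r) (antiDiagonal (k ℕ.* 4 ℕ.+ r)) ≡ det 0 r (antiDiagonal r)
  det-antiDiagonal-4* zero    r = refl
  det-antiDiagonal-4* (suc k) r = begin
    det 0 (4 ℕ.+ m) (antiDiagonal (4 ℕ.+ m))  ≡⟨ det-antiDiagonal-2+ (2 ℕ.+ m) ⟩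
    - det 0 (2 ℕ.+ m) (antiDiagonal (2 ℕ.+ m)) ≡⟨ cong -_ (det-antiDiagonal-2+ m) ⟩
    - - det 0 m (antiDiagonal m)              ≡⟨ ℤ.neg-involutive _ ⟩
    det 0 m (antiDiagonal m)                  ≡⟨ det-antiDiagonal-4* k r ⟩
    det 0 r (antiDiagonal r)                  ∎
    where m = k ℕ.* 4 ℕ.+ r

module AntiDiagonalPattern (q : ℕ) (p-prime : Prime (suc (suc q))) where

  open import Data.Nat using (_≤_; _<_; z≤n; s≤s; _∸_)
  import Data.Nat as ℕ
  import Data.Nat.Properties as ℕ
  import Data.Nat.Tactic.RingSolver as ℕ-Solver
  open import Data.Integer using (ℤ; +_; _*_; _^_; 0ℤ; 1ℤ; -1ℤ)
  open import Data.Nat.Combinatorics using (_C_)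
  import Data.Integer.Properties as ℤ
  open import Data.Fin using (toℕ)
  open import Data.Fin.Properties using (toℕ<n)
  open import Relation.Nullary using (yes; no; contradiction)
  open import Relation.Binary.PropositionalEquality using (_≢_)
  open import Relation.Binary.Definitions using (tri<; tri≈; tri>)
  open Congruence (suc (suc q))
  open Fermat (suc q) p-prime using (C[p-1,k]≈-1^k; -1^[p-1]≈1)
  open PowersOfX^[q+2]-X q
  open AntiDiagonal using (antiDiagonal; -1^m*-1^m≡1)
  open ≈-Reasoning

  private
    t p : ℕ
    t = suc q
    p = suc t

  coefficient-on-antiDiagonal : ∀ a b → a ℕ.+ b ≡ q → coefficient t (a ℕ.* p ℕ.+ suc b) ≈ 1ℤ
  coefficient-on-antiDiagonal a b a+b≡q = begin
    coefficient t (a ℕ.* p ℕ.+ suc b)         ≡⟨ cong (coefficient t) index ⟩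
    coefficient t (t ℕ.+ a ℕ.* t)             ≡⟨ coefficient-on t a ⟩
    -1ℤ ^ (t ℕ.+ a) * + (t C a)               ≈⟨ *-cong (≈-refl { -1ℤ ^ (t ℕ.+ a)}) (C[p-1,k]≈-1^k a a≤t) ⟩
    -1ℤ ^ (t ℕ.+ a) * -1ℤ ^ a                 ≡⟨ cong (_* -1ℤ ^ a) (ℤ.^-distribˡ-+-* -1ℤ t a) ⟩
    -1ℤ ^ t * -1ℤ ^ a * -1ℤ ^ a               ≡⟨ ℤ.*-assoc (-1ℤ ^ t) (-1ℤ ^ a) (-1ℤ ^ a) ⟩
    -1ℤ ^ t * (-1ℤ ^ a * -1ℤ ^ a)             ≡⟨ cong (-1ℤ ^ t *_) (-1^m*-1^m≡1 a) ⟩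
    -1ℤ ^ t * 1ℤ                              ≡⟨ ℤ.*-identityʳ (-1ℤ ^ t) ⟩
    -1ℤ ^ t                                   ≈⟨ -1^[p-1]≈1 ⟩
    1ℤ                                        ∎
    where
    a≤t : a ≤ t
    a≤t = ℕ.≤-trans (ℕ.m≤m+n a b) (ℕ.≤-trans (ℕ.≤-reflexive a+b≡q) (ℕ.n≤1+n q))
    index : a ℕ.* p ℕ.+ suc b ≡ t ℕ.+ a ℕ.* t
    index = subst (λ q → a ℕ.* suc (suc q) ℕ.+ suc b ≡ suc q ℕ.+ a ℕ.* suc q) a+b≡q (identity a b)
      where identity : ∀ a b → a ℕ.* suc (suc (a ℕ.+ b)) ℕ.+ suc b ≡ suc (a ℕ.+ b) ℕ.+ a ℕ.* suc (a ℕ.+ b)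
            identity = ℕ-Solver.solve-∀

  coefficient-off-antiDiagonal : ∀ a b → a < t → b < t → a ℕ.+ b ≢ q → coefficient t (a ℕ.* p ℕ.+ suc b) ≡ 0ℤ
  coefficient-off-antiDiagonal a b a<t b<t a+b≢q with ℕ.<-cmp (a ℕ.+ b) q
  ... | tri≈ _ a+b≡q _ = contradiction a+b≡q a+b≢q
  ... | tri< a+b<q _ _ = below a a+b<q
    where
    below : ∀ a → a ℕ.+ b < q → coefficient t (a ℕ.* p ℕ.+ suc b) ≡ 0ℤ
    below zero     b<q    = coefficient-below t (suc b) (s≤s b<q)
    below (suc a′) a+b<q = trans (cong (coefficient t) (identity a′ b q))
                                 (coefficient-off t a′ (suc (suc a′ ℕ.+ b)) (s≤s z≤n) (s≤s a+b<q))
      where identity : ∀ a′ b q →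
                       suc a′ ℕ.* suc (suc q) ℕ.+ suc b ≡ suc q ℕ.+ (a′ ℕ.* suc q ℕ.+ suc (suc a′ ℕ.+ b))
            identity = ℕ-Solver.solve-∀
  ... | tri> _ _ q<a+b = trans (cong (coefficient t) index) (coefficient-off t a (suc s) (s≤s z≤n) (s≤s s<q))
    where
    s : ℕ
    s = a ℕ.+ b ∸ suc q
    a+b≡t+s : a ℕ.+ b ≡ suc q ℕ.+ s
    a+b≡t+s = sym (ℕ.m+[n∸m]≡n q<a+b)
    index : a ℕ.* p ℕ.+ suc b ≡ t ℕ.+ (a ℕ.* t ℕ.+ suc s)
    index = trans (expand a b q) (trans (cong (λ u → suc (a ℕ.* suc q ℕ.+ u)) a+b≡t+s) (regroup a q s))
      where expand : ∀ a b q → a ℕ.* suc (suc q) ℕ.+ suc b ≡ suc (a ℕ.* suc q ℕ.+ (a ℕ.+ b))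
            expand = ℕ-Solver.solve-∀
            regroup : ∀ a q s → suc (a ℕ.* suc q ℕ.+ (suc q ℕ.+ s)) ≡ suc q ℕ.+ (a ℕ.* suc q ℕ.+ suc s)
            regroup = ℕ-Solver.solve-∀
    s<q : s < q
    s<q = ℕ.+-cancelˡ-< q s q (subst (ℕ._≤ q ℕ.+ q) a+b≡t+s
                                      (ℕ.+-mono-≤ (ℕ.s≤s⁻¹ a<t) (ℕ.s≤s⁻¹ b<t)))

  coefficient-antiDiagonal : ∀ (i j : Fin t) → coefficient t (toℕ i ℕ.* p ℕ.+ suc (toℕ j)) ≈ antiDiagonal t i j
  coefficient-antiDiagonal i j with toℕ i ℕ.+ toℕ j ℕ.≟ t ∸ 1
  ... | yes i+j≡q = coefficient-on-antiDiagonal (toℕ i) (toℕ j) i+j≡q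
  ... | no  i+j≢q = ≈-reflexive (coefficient-off-antiDiagonal (toℕ i) (toℕ j) (toℕ<n i) (toℕ<n j) i+j≢q)

module SpecialisationAtResidues (q : ℕ) (p-prime : Prime (suc (suc q))) where

  open import Data.Nat using (_∸_; _%_; _/_)
  open import Data.Nat.DivMod using (m≡m%n+[m/n]*n)
  open import Data.Product using (_×_; _,_)
  open import Data.Sum using (_⊎_; [_,_]′)
  import Data.Nat as ℕ
  import Data.Nat.Properties as ℕ
  open import Data.Integer using (ℤ; +_; _+_; _-_; -_; _*_; _^_; 0ℤ; 1ℤ)
  import Data.Integer.Properties as ℤ
  open import Data.Integer.Tactic.RingSolver using (solve-∀)
  open import Data.Bool using (true; false; if_then_else_; T)
  open import Data.Unit using (tt)
  open import Data.Fin using (toℕ)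
  open import Data.List using ([]; _∷_; map; allFin; concatMap)
  open import Data.List.Properties using (map-∘; map-cong)
  import Data.List.Relation.Unary.All as All
  import Data.List.Relation.Unary.All.Properties as All
  open import Relation.Nullary using (¬_)
  open import Data.Fin.Properties using (toℕ<n)
  open Evaluation
  open Congruence (suc (suc q))
  open PolyCongruence (suc (suc q)) using (coeff-≈; powP-cong)
  open Fermat (suc q) p-prime using (fermat-unit)
  open LinearFactors q p-prime using (linearFactor; linearFactors; linearFactors≋X^p-X)
  open AntiDiagonalPattern q p-prime using (coefficient-antiDiagonal)
  open AntiDiagonal using (antiDiagonal; det-antiDiagonal-4*)

  private
    t p : ℕ
    t = suc q
    p = suc t

  residue : Fin p → ℤ
  residue i = + toℕ i

  δ-factor : Fin p → Fin p → Poly p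
  δ-factor i j = if toℕ i ℕ.<ᵇ toℕ j then subP p (var p i) (var p j) else oneP p

  δ-factor-≉0 : ∀ i j → ¬ eval p residue (δ-factor i j) ≈ 0ℤ
  δ-factor-≉0 i j with toℕ i ℕ.<ᵇ toℕ j in i<ᵇj
  ... | true  = λ i-j≈0 → <⇒≉ (ℕ.<ᵇ⇒< (toℕ i) (toℕ j) (subst T (sym i<ᵇj) tt)) (toℕ<n j)
                  (-≈0⇒≈ (subst (_≈ 0ℤ) (trans (eval-subP p residue (var p i) (var p j))
                                               (cong₂ _-_ (eval-var p residue i) (eval-var p residue j))) i-j≈0))
  ... | false = λ 1≈0 → 1≉0 p-prime (subst (_≈ 0ℤ) (eval-oneP p residue) 1≈0)

  δ-≉0 : ¬ eval p residue (delta p) ≈ 0ℤ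
  δ-≉0 δ≈0 = prodP-≉0 p-prime factors≉0 (subst (_≈ 0ℤ) (eval-prodP p residue δ-factors) δ≈0)
    where
    δ-factors = concatMap (λ i → map (δ-factor i) (allFin p)) (allFin p)
    factors≉0 : All.All (λ x → ¬ x ≈ 0ℤ) (map (eval p residue) δ-factors)
    factors≉0 = All.map⁺ (All.concat⁺ (All.map⁺ (All.universal
                  (λ i → All.map⁺ (All.universal (δ-factor-≉0 i) (allFin p))) (allFin p))))

  open CoefficientMap (eval p residue) (eval-zeroP p residue) (eval-oneP p residue)
                      (eval-addP p residue) (eval-negP p residue) (eval-mulP p residue)

  evalCoeffs-fPoly : map (eval p residue) (fPoly p) ≡ linearFactors
  evalCoeffs-fPoly = begin
    map (eval p residue) (prodP (suc p) (map factor (allFin p)))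
      ≡⟨ map-prodP (map factor (allFin p)) ⟩
    prodP 1 (map (map (eval p residue)) (map factor (allFin p)))
      ≡⟨ cong (prodP 1) (map-∘ {g = map (eval p residue)} {f = factor} (allFin p)) ⟨
    prodP 1 (map (map (eval p residue) ∘ factor) (allFin p))
      ≡⟨ cong (prodP 1) (map-cong evalCoeffs-factor (allFin p)) ⟩
    linearFactors ∎
    where
    open Relation.Binary.PropositionalEquality.≡-Reasoning
    factor : Fin p → Poly (suc p)
    factor i = subP (suc p) (var (suc p) Fin.zero) (var (suc p) (Fin.suc i))
    evalCoeffs-factor : ∀ i → map (eval p residue) (factor i) ≡ linearFactor i
    evalCoeffs-factor i = trans (map-subP (var (suc p) Fin.zero) (var (suc p) (Fin.suc i)))
      (cong₂ (subP 1) (cong₂ (λ a b → a ∷ b ∷ []) (eval-zeroP p residue) (eval-oneP p residue))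
                      (cong (_∷ []) (eval-var p residue i)))

  Mmat-index : ∀ a b → + (suc a ℕ.* p ℕ.+ suc b) - + (t ℕ.+ 1) ≡ + (a ℕ.* p ℕ.+ suc b)
  Mmat-index a b = begin
    + (suc a ℕ.* p ℕ.+ suc b) - + (t ℕ.+ 1)
      ≡⟨ cong₂ (λ m n → + m - + n) (ℕ.+-assoc p (a ℕ.* p) (suc b)) (ℕ.+-comm t 1) ⟩
    + (p ℕ.+ (a ℕ.* p ℕ.+ suc b)) - + p        ≡⟨ cong (_- + p) (ℤ.pos-+ p (a ℕ.* p ℕ.+ suc b)) ⟩
    + p + + (a ℕ.* p ℕ.+ suc b) - + p          ≡⟨ cancel (+ p) (+ (a ℕ.* p ℕ.+ suc b)) ⟩
    + (a ℕ.* p ℕ.+ suc b)                      ∎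
    where open Relation.Binary.PropositionalEquality.≡-Reasoning
          cancel : ∀ x y → x + y - x ≡ y
          cancel = solve-∀

  eval-Mmat : ∀ i j → eval p residue (Mmat p p t (powP (suc p) (fPoly p) t) i j) ≡
                      coeff 0 (powP 1 linearFactors t) (toℕ i ℕ.* p ℕ.+ suc (toℕ j))
  eval-Mmat i j = trans (sym (coeffℤ-map (powP (suc p) (fPoly p) t) index))
    (cong₂ (coeffℤ 0) (trans (map-powP (fPoly p) t) (cong (λ f → powP 1 f t) evalCoeffs-fPoly))
                      (Mmat-index (toℕ i) (toℕ j)))
    where index = + (suc (toℕ i) ℕ.* p ℕ.+ suc (toℕ j)) - + (t ℕ.+ 1)

  ε≈det-antiDiagonal : ∀ ε → EqP p p (det p t (Mmat p p t (powP (suc p) (fPoly p) t)))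
                                     (mulP p (constP p ε) (powP p (delta p) (2 ℕ.* t ∸ t))) →
                       ε ≈ det 0 t (antiDiagonal t)
  ε≈det-antiDiagonal ε hyp = begin
    ε                                                         ≡⟨ ℤ.*-identityʳ ε ⟨
    ε * 1ℤ                                                    ≈⟨ *-cong (≈-refl {ε}) (≈-sym (fermat-unit δ-≉0)) ⟩
    ε * eval p residue (delta p) ^ t                          ≡⟨ eval-rhs ⟨
    eval p residue rhs                                        ≈⟨ eval-EqP p p residue {lhs} {rhs} hyp ⟨
    eval p residue (det p t (Mmat p p t (powP (suc p) (fPoly p) t)))
      ≡⟨ eval-det p residue t (Mmat p p t (powP (suc p) (fPoly p) t))
                  (λ i j → coeff 0 (powP 1 linearFactors t) (toℕ i ℕ.* p ℕ.+ suc (toℕ j))) eval-Mmat ⟩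
    det 0 t (λ i j → coeff 0 (powP 1 linearFactors t) (toℕ i ℕ.* p ℕ.+ suc (toℕ j)))
      ≈⟨ det-cong t (λ i j → ≈-trans (coeff-≈ (powP-cong linearFactors≋X^p-X t) (toℕ i ℕ.* p ℕ.+ suc (toℕ j)))
                                     (coefficient-antiDiagonal i j)) ⟩
    det 0 t (antiDiagonal t)                                  ∎
    where
    open ≈-Reasoning
    lhs rhs : Poly p
    lhs = det p t (Mmat p p t (powP (suc p) (fPoly p) t))
    rhs = mulP p (constP p ε) (powP p (delta p) (2 ℕ.* t ∸ t))
    2t∸t≡t : 2 ℕ.* t ∸ t ≡ t
    2t∸t≡t = trans (ℕ.m+n∸m≡n t (t ℕ.+ 0)) (ℕ.+-identityʳ t)
    eval-rhs : eval p residue rhs ≡ ε * eval p residue (delta p) ^ t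
    eval-rhs = trans (eval-mulP p residue (constP p ε) (powP p (delta p) (2 ℕ.* t ∸ t)))
                     (cong₂ _*_ (eval-constP p residue ε)
                                (trans (eval-powP p residue (delta p) (2 ℕ.* t ∸ t))
                                       (cong (eval p residue (delta p) ^_) 2t∸t≡t)))

  det-antiDiagonal-by-residue : ∀ r → p % 4 ≡ suc r → det 0 t (antiDiagonal t) ≡ det 0 r (antiDiagonal r)
  det-antiDiagonal-by-residue r p%4≡1+r =
    trans (cong (λ m → det 0 m (antiDiagonal m)) t≡[p/4]*4+r) (det-antiDiagonal-4* (p / 4) r)
    where t≡[p/4]*4+r : t ≡ p / 4 ℕ.* 4 ℕ.+ r
          t≡[p/4]*4+r = trans (cong ℕ.pred (trans (m≡m%n+[m/n]*n p 4) (cong (ℕ._+ p / 4 ℕ.* 4) p%4≡1+r)))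
                              (ℕ.+-comm r (p / 4 ℕ.* 4))

  ε-by-residue : ∀ {ε} → ε ≈ det 0 t (antiDiagonal t) →
                 ((p % 4 ≡ 1 ⊎ p % 4 ≡ 2) → ε ≡ + 1 [modℤ p ]) × (p % 4 ≡ 3 → ε ≡ - (+ 1) [modℤ p ])
  ε-by-residue {ε} ε≈det = [ ε≡ 0 , ε≡ 1 ]′ , ε≡ 2
    where ε≡ : ∀ r → p % 4 ≡ suc r → ε ≡ det 0 r (antiDiagonal r) [modℤ p ]
          ε≡ r p%4≡1+r = ≈⇒≡[modℤ] (≈-trans ε≈det (≈-reflexive (det-antiDiagonal-by-residue r p%4≡1+r)))

module MembershipInB0 where

  open import Data.Nat using (_≤_; _∸_; _*_)
  import Data.Nat as ℕ
  import Data.Nat.Properties as ℕ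
  open import Data.Nat.Divisibility using (_∣_; divides)
  open import Data.Product using (_×_; _,_)
  open import Relation.Nullary using (¬_; contradiction)

  multiple-in-[2,p+1]⇒≡p : ∀ q {r} k → 2 ≤ r → r ≤ suc (suc (suc q)) → r ≡ k * suc (suc q) → r ≡ suc (suc q)
  multiple-in-[2,p+1]⇒≡p q zero          2≤r _     refl = contradiction 2≤r λ ()
  multiple-in-[2,p+1]⇒≡p q (suc zero)    _   _     r≡p  = trans r≡p (ℕ.+-identityʳ (suc (suc q)))
  multiple-in-[2,p+1]⇒≡p q (suc (suc k)) _   r≤p+1 refl =
    contradiction (ℕ.≤-trans (ℕ.+-monoʳ-≤ p (ℕ.m≤m+n p (k * p))) r≤p+1) p+p≰p+1
    where
    p = suc (suc q)
    p+p≰p+1 : ¬ p ℕ.+ p ≤ suc p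
    p+p≰p+1 p+p≤p+1 = ℕ.1+n≰n (ℕ.≤-trans (ℕ.m≤n+m (suc (suc q)) q) (ℕ.s≤s⁻¹ (ℕ.s≤s⁻¹ p+p≤p+1)))

  e≡p-1 : ∀ q e → e ≤ suc q → suc (suc q) * (suc q ∸ e) ≤ suc q → e ≡ suc q
  e≡p-1 q e e≤p-1 bound with suc q ∸ e in p-1-e≡
  ... | zero  = ℕ.≤-antisym e≤p-1 (ℕ.m∸n≡0⇒m≤n p-1-e≡)
  ... | suc z = contradiction (ℕ.≤-trans (ℕ.m≤m*n (suc (suc q)) (suc z)) bound) ℕ.1+n≰n

  InB0-∣⇒ : ∀ q {r e d} → InB0 (suc (suc q)) r e d → suc (suc q) ∣ r → r ≡ suc (suc q) × e ≡ suc q × d ≡ suc q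
  InB0-∣⇒ q {e = e} (2≤r , r≤p+1 , _ , e≤p-1 , bound , d≡r-1) (divides k r≡kp) =
    r≡p , e≡p-1 q e e≤p-1 (subst (λ r → r * (suc q ∸ e) ≤ suc q) r≡p bound) , d≡p-1
    where
    r≡p = multiple-in-[2,p+1]⇒≡p q k 2≤r r≤p+1 r≡kp
    d≡p-1 = trans d≡r-1 (cong (_∸ 1) r≡p)

-- Opened only here, since the modules above use Data.Integer's _*_ and _∣_ unqualified.
open import Data.Nat using (_∸_; _%_; _*_)
open import Data.Nat.Divisibility using (_∣_)
open import Data.Nat.Primality using (prime)
open import Data.Integer using (ℤ; +_; -_)
open import Data.Product using (_×_; _,_)
open import Data.Sum using (_⊎_)
open MembershipInB0 using (InB0-∣⇒)

proposition5 : (p : ℕ) → Prime p → (r e d : ℕ) → InB0 p r e d → p ∣ r →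
    (r ≡ p × e ≡ p ∸ 1 × d ≡ p ∸ 1) ×
    ((ε : ℤ) →
      EqP p r (det r d (Mmat p r d (powP (suc r) (fPoly r) e)))
              (mulP r (constP r ε) (powP r (delta r) (2 * e ∸ (p ∸ 1)))) →
      ((p % 4 ≡ 1 ⊎ p % 4 ≡ 2) → ε ≡ + 1 [modℤ p ]) ×
      (p % 4 ≡ 3 → ε ≡ - (+ 1) [modℤ p ]))
proposition5 0             (prime {{()}} _)
proposition5 1             (prime {{()}} _)
proposition5 (suc (suc q)) p-prime r e d r,e,d∈B0 p∣r with InB0-∣⇒ q r,e,d∈B0 p∣r
... | refl , refl , refl = (refl , refl , refl) , λ ε hyp → ε-by-residue (ε≈det-antiDiagonal ε hyp)
  where open SpecialisationAtResidues q p-prime using (ε≈det-antiDiagonal; ε-by-residue)
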